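{- Let $m,n,r$ be positive integers and let $\mathcal{P}=\mathrm{Pyr}^r(\mathcal{T}_m)\times [0,n]^n$, an integral polytope of dimension $n+r+3$. Then for all sufficiently large $m$ (with $n,r\ge 1$ fixed), the coefficient of $t^{j}$ in the Ehrhart polynomial $i(\mathcal{P},t)$ is negative for every $1\le j\le n+1$.
   Context: An integral polytope is a convex polytope all of whose vertices have integer coordinates. For an integral polytope $\mathcal{P}\subseteq\mathbb{R}^N$ of dimension $d$, $i(\mathcal{P},t)=|t\mathcal{P}\cap\mathbb{Z}^N|$ for positive integers $t$ is a polynomial in $t$ of degree $d$ (the Ehrhart polynomial). For a positive integer $m$, the Reeve tetrahedron $\mathcal{T}_m\subseteq\mathbb{R}^3$ is the convex hull of $(0,0,0),(1,0,0),(0,1,0),(1,1,m)$. For a polytope $\mathcal{P}\subseteq\mathbb{R}^N$ with vertices $v_1,\dots,v_s$, its pyramid is $\mathrm{Pyr}(\mathcal{P})=\mathrm{conv}\{(v_1,0),\dots,(v_s,0),(0,\dots,0,1)\}\subseteq\mathbb{R}^{N+1}$, and $\mathrm{Pyr}^k(\mathcal{P})$ for $k\ge2$ is defined recursively as $\mathrm{Pyr}(\mathrm{Pyr}^{k-1}(\mathcal{P}))$ (with $\mathrm{Pyr}^1=\mathrm{Pyr}$). $\times$ denotes the Cartesian product of polytopes, and $[0,n]^n\subseteq\mathbb{R}^n$ is the cube of side length $n$. -}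

module Defs where

open import Data.Nat as ℕ using (ℕ; zero; suc)
open import Data.Integer as ℤ using (ℤ; +_)
open import Data.Rational as ℚ using (ℚ; 0ℚ; 1ℚ)
open import Data.Fin using (Fin)
open import Data.Vec using (Vec; []; _∷_; _∷ʳ_; _++_; map; replicate; lookup; tabulate; foldr)
open import Data.Product using (Σ; _×_; ∃)
open import Relation.Binary.PropositionalEquality using (_≡_)
open import Function.Definitions using (Injective)

ℤ→ℚ : ℤ → ℚ
ℤ→ℚ z = z ℚ./ 1

-- a (rational) region of ℝ^N is given by its membership predicate on ℚ^N
-- (all polytopes here have rational vertices, so membership of rational
-- points is all that is ever needed for counting lattice points)
Region : ℕ → Set₁
Region N = Vec ℚ N → Set

sumℚ : ∀ {k} → Vec ℚ k → ℚ
sumℚ = foldr _ ℚ._+_ 0ℚ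

lincomb : ∀ {k N} → Vec ℚ k → Vec (Vec ℤ N) k → Vec ℚ N
lincomb {k} c V = tabulate (λ j → sumℚ (tabulate (λ i → lookup c i ℚ.* ℤ→ℚ (lookup (lookup V i) j))))

conv : ∀ {k N} → Vec (Vec ℤ N) k → Region N
conv {k} V y = Σ (Vec ℚ k) λ c → ((i : Fin k) → 0ℚ ℚ.≤ lookup c i) × (sumℚ c ≡ 1ℚ) × (y ≡ lincomb c V)

dilate : ∀ {N} → ℕ → Region N → Region N
dilate t P x = Σ _ λ y → P y × (x ≡ map (λ q → ℤ→ℚ (+ t) ℚ.* q) y)

_⊠_ : ∀ {N M} → Region N → Region M → Region (N ℕ.+ M)
(P ⊠ Q) x = Σ _ λ y → Σ _ λ z → (x ≡ y ++ z) × P y × Q z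

cube : (a n : ℕ) → Region n
cube a n x = (i : Fin n) → (0ℚ ℚ.≤ lookup x i) × (lookup x i ℚ.≤ ℤ→ℚ (+ a))

pyr : ∀ {k N} → Vec (Vec ℤ N) k → Vec (Vec ℤ (suc N)) (suc k)
pyr {k} {N} V = map (λ v → v ∷ʳ + 0) V ∷ʳ (replicate N (+ 0) ∷ʳ + 1)

pyrⁿ : ∀ {k N} (r : ℕ) → Vec (Vec ℤ N) k → Vec (Vec ℤ (r ℕ.+ N)) (r ℕ.+ k)
pyrⁿ zero V = V
pyrⁿ (suc r) V = pyr (pyrⁿ r V)

reeveVerts : ℕ → Vec (Vec ℤ 3) 4
reeveVerts m = (+ 0 ∷ + 0 ∷ + 0 ∷ []) ∷ (+ 1 ∷ + 0 ∷ + 0 ∷ []) ∷ (+ 0 ∷ + 1 ∷ + 0 ∷ [])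
             ∷ (+ 1 ∷ + 1 ∷ + m ∷ []) ∷ []

thePolytope : (m n r : ℕ) → Region ((r ℕ.+ 3) ℕ.+ n)
thePolytope m n r = conv (pyrⁿ r (reeveVerts m)) ⊠ cube n n

LatticeCount : ∀ {N} → Region N → ℕ → Set
LatticeCount {N} S c =
  Σ (Fin c → Vec ℤ N) λ f → Injective _≡_ _≡_ f
    × ((i : Fin c) → S (map ℤ→ℚ (f i)))
    × ((x : Vec ℤ N) → S (map ℤ→ℚ x) → ∃ λ i → f i ≡ x)

-- evaluation of a₀ + a₁ x + … + a_d x^d (coefficient of x^j is lookup a j)
evalPoly : ∀ {k} → Vec ℚ k → ℚ → ℚ
evalPoly [] x = 0ℚ
evalPoly (a ∷ as) x = a ℚ.+ x ℚ.* evalPoly as x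

IsEhrhartPoly : ∀ {N k} → Region N → Vec ℚ k → Set
IsEhrhartPoly P a = (t : ℕ) → 1 ℕ.≤ t → Σ ℕ λ c → LatticeCount (dilate t P) c × (evalPoly a (ℤ→ℚ (+ t)) ≡ ℤ→ℚ (+ c))

module Submission where

-- The lattice points of t·P are pairs of lattice points of t·Pyr^r(T_m) and of [0, tn]^n.
-- Slicing a pyramid by its last coordinate gives i(Pyr B, t) = Σ_{s ≤ t} i(B, s), and sorting
-- the lattice points (x, y, z) of s·T_m by the residue of z modulo m identifies them with those
-- of s·Δ₃ and of m − 1 copies of (s − 2)·Δ₃. Hence
--   (r+3)!·i(P, t) = Q(t)·(t+1)⋯(t+r+1)·(1+nt)^n,  Q(t) = m t² + (2(r+3) − m) t + (r+2)(r+3).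
-- Write R for the product of the last two factors. The coefficients of (1+nt)^n increase up to
-- index n (strictly before n), and each factor t + c makes them strictly increasing, so
-- R_j − R_{j−1} ≥ 1 for j ≤ n. The coefficient of t^{j+1} in Q·R is
-- (r+2)(r+3)·R_{j+1} + 2(r+3)·R_j − m·(R_j − R_{j−1}), negative once m exceeds the first two terms
-- for every j ≤ n.

module Enumerations where

  open import Level using (0ℓ)
  open import Data.Nat as ℕ using (ℕ)
  open import Data.Fin using (Fin)
  open import Data.Fin.Properties using (+↔⊎; *↔×)
  open import Data.Product as Product using (Σ; ∃; _×_; _,_; proj₁; proj₂)
  open import Data.Sum using (inj₁; inj₂; [_,_])
  open import Data.Empty using (⊥-elim)
  open import Function using (_∘_; _↔_; Inverse)
  open import Function.Definitions using (Injective)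
  open import Relation.Unary using (Pred; _∈_; _≐_; _∪_; _⊥_; _⟨×⟩_; ｛_｝; Empty; U)
  open import Relation.Binary.PropositionalEquality using (_≡_; refl; sym; trans; cong; cong₂; subst)

  Enumerates : {A I : Set} → (I → A) → Pred A 0ℓ → Set
  Enumerates f P = Injective _≡_ _≡_ f × (∀ i → f i ∈ P) × (∀ x → x ∈ P → ∃ λ i → f i ≡ x)

  -- Shaped so that LatticeCount S c unfolds to Enumeration (λ x → S (map ℤ→ℚ x)) c.
  Enumeration : {A : Set} → Pred A 0ℓ → ℕ → Set
  Enumeration {A} P c = Σ (Fin c → A) λ f → Enumerates f P

  Image : {A B : Set} → (A → B) → Pred A 0ℓ → Pred B 0ℓ
  Image g P y = ∃ λ x → x ∈ P × g x ≡ y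

  InjectiveOn : {A B : Set} → (A → B) → Pred A 0ℓ → Set
  InjectiveOn g P = ∀ {x y} → x ∈ P → y ∈ P → g x ≡ g y → x ≡ y

  module _ {A : Set} where

    enumerates-reindex : ∀ {I J : Set} {P : Pred A 0ℓ} {f : J → A} (e : I ↔ J) →
      Enumerates f P → Enumerates (f ∘ Inverse.to e) P
    enumerates-reindex {f = f} e (inj , f∈P , onto) =
      (λ eq → trans (sym (strictlyInverseʳ _)) (trans (cong from (inj eq)) (strictlyInverseʳ _))) ,
      (λ i → f∈P (to i)) ,
      λ x x∈P → let (j , fj≡x) = onto x x∈P in from j , trans (cong f (strictlyInverseˡ j)) fj≡x
      where open Inverse e

    enumerates-∪ : ∀ {I J : Set} {P Q : Pred A 0ℓ} {f : I → A} {g : J → A} → P ⊥ Q →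
      Enumerates f P → Enumerates g Q → Enumerates [ f , g ] (P ∪ Q)
    enumerates-∪ {P = P} {Q} {f} {g} P⊥Q (f-inj , f∈P , f-onto) (g-inj , g∈Q , g-onto) =
      inj , [ inj₁ ∘ f∈P , inj₂ ∘ g∈Q ] , onto
      where
      inj : Injective _≡_ _≡_ [ f , g ]
      inj {inj₁ i} {inj₁ j} eq = cong inj₁ (f-inj eq)
      inj {inj₁ i} {inj₂ j} eq = ⊥-elim (P⊥Q (f∈P i , subst (_∈ Q) (sym eq) (g∈Q j)))
      inj {inj₂ i} {inj₁ j} eq = ⊥-elim (P⊥Q (f∈P j , subst (_∈ Q) eq (g∈Q i)))
      inj {inj₂ i} {inj₂ j} eq = cong inj₂ (g-inj eq)
      onto : ∀ x → x ∈ P ∪ Q → ∃ λ k → [ f , g ] k ≡ x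
      onto x (inj₁ x∈P) = let (i , fi≡x) = f-onto x x∈P in inj₁ i , fi≡x
      onto x (inj₂ x∈Q) = let (j , gj≡x) = g-onto x x∈Q in inj₂ j , gj≡x

    enum-≐ : ∀ {P Q : Pred A 0ℓ} {c} → P ≐ Q → Enumeration P c → Enumeration Q c
    enum-≐ (P⊆Q , Q⊆P) (f , inj , f∈P , onto) = f , inj , P⊆Q ∘ f∈P , λ x → onto x ∘ Q⊆P

    enum-∅ : ∀ {P : Pred A 0ℓ} → Empty P → Enumeration P 0
    enum-∅ P-empty = (λ ()) , (λ { {()} }) , (λ ()) , λ x x∈P → ⊥-elim (P-empty x x∈P)

    enum-｛｝ : (a : A) → Enumeration ｛ a ｝ 1
    enum-｛｝ a = (λ _ → a) , (λ { {Fin.zero} {Fin.zero} _ → refl }) , (λ _ → refl) , λ x a≡x → Fin.zero , a≡x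

    enum-∪ : ∀ {P Q : Pred A 0ℓ} {c d} → P ⊥ Q → Enumeration P c → Enumeration Q d → Enumeration (P ∪ Q) (c ℕ.+ d)
    enum-∪ P⊥Q (f , f-enum) (g , g-enum) = _ , enumerates-reindex +↔⊎ (enumerates-∪ P⊥Q f-enum g-enum)

  enum-U : ∀ {k} → Enumeration {Fin k} U k
  enum-U = (λ i → i) , (λ eq → eq) , _ , λ i _ → i , refl

  enum-image : ∀ {A B : Set} {P : Pred A 0ℓ} {c} (g : A → B) → InjectiveOn g P → Enumeration P c → Enumeration (Image g P) c
  enum-image g g-inj (f , f-inj , f∈P , onto) =
    g ∘ f , (λ eq → f-inj (g-inj (f∈P _) (f∈P _) eq)) , (λ i → f _ , f∈P i , refl) ,
    λ { y (x , x∈P , refl) → Product.map₂ (cong g) (onto x x∈P) }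

  enum-⟨×⟩ : ∀ {A B : Set} {P : Pred A 0ℓ} {Q : Pred B 0ℓ} {c d} →
    Enumeration P c → Enumeration Q d → Enumeration (P ⟨×⟩ Q) (c ℕ.* d)
  enum-⟨×⟩ {A} {B} {P} {Q} {c} {d} (f , f-inj , f∈P , f-onto) (g , g-inj , g∈Q , g-onto) =
    _ , enumerates-reindex *↔× (inj , (λ (i , j) → f∈P i , g∈Q j) , onto)
    where
    f×g : Fin c × Fin d → A × B
    f×g = Product.map f g
    inj : Injective _≡_ _≡_ f×g
    inj eq = cong₂ _,_ (f-inj (cong proj₁ eq)) (g-inj (cong proj₂ eq))
    onto : ∀ p → p ∈ (P ⟨×⟩ Q) → ∃ λ k → f×g k ≡ p
    onto (x , y) (x∈P , y∈Q) =
      let (i , fi≡x) = f-onto x x∈P ; (j , gj≡y) = g-onto y y∈Q in (i , j) , cong₂ _,_ fi≡x gj≡y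

module IntegerLemmas where

  open import Data.Nat using (ℕ; zero; suc; z≤n; s≤s)
  import Data.Nat as ℕ
  import Data.Nat.Properties as ℕ
  open import Data.Integer using (ℤ; +_; -[1+_]; 0ℤ; +≤+; -≤+; -<+; _+_; _*_; _≤_; _<_; ∣_∣; nonNegative)
  import Data.Integer as ℤ using (suc)
  import Data.Integer.Properties as ℤ
  open import Data.Integer.Tactic.RingSolver using (solve-∀)
  open import Algebra.Properties.AbelianGroup ℤ.+-0-abelianGroup using (∙-cancelˡ; ∙-cancelʳ)
  open import Data.Product using (∃; _×_; _,_)
  open import Data.Sum using (inj₁; inj₂)
  open import Data.Empty using (⊥-elim)
  open import Relation.Binary.Definitions using (tri<; tri≈; tri>)
  open import Relation.Binary.PropositionalEquality using (_≡_; refl; sym; subst)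

  0≤+ : ∀ n → 0ℤ ≤ + n
  0≤+ _ = +≤+ z≤n

  0≤-+ : ∀ {a b} → 0ℤ ≤ a → 0ℤ ≤ b → 0ℤ ≤ a + b
  0≤-+ = ℤ.+-mono-≤

  0≤-* : ∀ {a b} → 0ℤ ≤ a → 0ℤ ≤ b → 0ℤ ≤ a * b
  0≤-* (+≤+ {n = m} _) (+≤+ {n = n} _) = subst (0ℤ ≤_) (ℤ.pos-* m n) (0≤+ (m ℕ.* n))

  +-cancelˡ-≡ : ∀ a b c → a + b ≡ a + c → b ≡ c
  +-cancelˡ-≡ = ∙-cancelˡ

  +-cancelʳ-≡ : ∀ a b c → b + a ≡ c + a → b ≡ c
  +-cancelʳ-≡ = ∙-cancelʳ

  1≤-* : ∀ {a b} → + 1 ≤ a → + 1 ≤ b → + 1 ≤ a * b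
  1≤-* {+ suc m} {+ suc n} (+≤+ _) (+≤+ _) = +≤+ (s≤s z≤n)

  ≤-+-nonneg : ∀ {a b c} → a ≤ b → 0ℤ ≤ c → a ≤ c + b
  ≤-+-nonneg {c = c} a≤b 0≤c = ℤ.i≤j⇒i≤k+j c {{nonNegative 0≤c}} a≤b

  i≤+∣i∣ : ∀ i → i ≤ + ∣ i ∣
  i≤+∣i∣ (+ n) = ℤ.≤-refl
  i≤+∣i∣ -[1+ n ] = -≤+

  finite-bound : (f : ℕ → ℤ) (n : ℕ) → ∃ λ B → ∀ j → j ℕ.≤ n → f j ≤ + B
  finite-bound f zero = ∣ f 0 ∣ , λ { zero _ → i≤+∣i∣ (f 0) }
  finite-bound f (suc n) with finite-bound f n
  ... | B , below = B ℕ.⊔ ∣ f (suc n) ∣ , bound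
    where
    bound : ∀ j → j ℕ.≤ suc n → f j ≤ + (B ℕ.⊔ ∣ f (suc n) ∣)
    bound j j≤1+n with ℕ.m≤n⇒m<n∨m≡n j≤1+n
    ... | inj₁ j<1+n = ℤ.≤-trans (below j (ℕ.≤-pred j<1+n)) (+≤+ (ℕ.m≤m⊔n B _))
    ... | inj₂ refl = ℤ.≤-trans (i≤+∣i∣ (f (suc n))) (+≤+ (ℕ.m≤n⊔m B _))

  module _ (m : ℕ) where

    private
      M : ℤ
      M = + suc m

    M*u+r<M*[1+u] : ∀ u {r} → r < M → M * u + r < M * ℤ.suc u
    M*u+r<M*[1+u] u {r} r<M = begin-strict
      M * u + r       <⟨ ℤ.+-monoʳ-< (M * u) r<M ⟩
      M * u + M       ≡⟨ distrib M u ⟩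
      M * ℤ.suc u     ∎
      where
      open ℤ.≤-Reasoning
      distrib : ∀ M u → M * u + M ≡ M * (+ 1 + u)
      distrib = solve-∀

    quotient-nonneg : ∀ u {r} → 0ℤ ≤ M * u + r → r < M → 0ℤ ≤ u
    quotient-nonneg (+ n) _ _ = 0≤+ n
    quotient-nonneg -[1+ n ] {r} 0≤Mu+r r<M = ⊥-elim (ℤ.<-irrefl refl (begin-strict
      0ℤ               ≤⟨ 0≤Mu+r ⟩
      M * -[1+ n ] + r <⟨ M*u+r<M*[1+u] -[1+ n ] r<M ⟩
      M * ℤ.suc -[1+ n ] ≤⟨ ℤ.*-monoˡ-≤-nonNeg M (ℤ.i<j⇒suc[i]≤j (-<+ {m = n} {n = 0})) ⟩
      M * 0ℤ           ≡⟨ ℤ.*-zeroʳ M ⟩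
      0ℤ               ∎))
      where open ℤ.≤-Reasoning

    smaller-quotient : ∀ {a a' r r'} → a < a' → r < M → 0ℤ ≤ r' → M * a + r < M * a' + r'
    smaller-quotient {a} {a'} {r} {r'} a<a' r<M 0≤r' = begin-strict
      M * a + r        <⟨ M*u+r<M*[1+u] a r<M ⟩
      M * ℤ.suc a      ≤⟨ ℤ.*-monoˡ-≤-nonNeg M (ℤ.i<j⇒suc[i]≤j a<a') ⟩
      M * a'           ≡⟨ ℤ.+-identityʳ (M * a') ⟨
      M * a' + 0ℤ      ≤⟨ ℤ.+-monoʳ-≤ (M * a') 0≤r' ⟩
      M * a' + r'      ∎
      where open ℤ.≤-Reasoning

    euclid-unique : ∀ {a a' r r'} → 0ℤ ≤ r → r < M → 0ℤ ≤ r' → r' < M → M * a + r ≡ M * a' + r' → a ≡ a' × r ≡ r'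
    euclid-unique {a} {a'} {r} {r'} 0≤r r<M 0≤r' r'<M eq with ℤ.<-cmp a a'
    ... | tri≈ _ refl _ = refl , +-cancelˡ-≡ (M * a) r r' eq
    ... | tri< a<a' _ _ = ⊥-elim (ℤ.<-irrefl eq (smaller-quotient a<a' r<M 0≤r'))
    ... | tri> _ _ a'<a = ⊥-elim (ℤ.<-irrefl (sym eq) (smaller-quotient a'<a r'<M 0≤r))

module LatticePyramids where

  open import Level using (0ℓ)
  open import Data.Nat using (ℕ; zero; suc)
  import Data.Nat as ℕ
  open import Data.Integer using (ℤ; +_; 0ℤ; +≤+; _+_; _-_; _≤_)
  import Data.Integer as ℤ using (suc; pred)
  import Data.Integer.Properties as ℤ
  open import Data.Integer.Tactic.RingSolver using (solve-∀)
  open import Data.Vec using (Vec; _∷ʳ_)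
  open import Data.Vec.Properties using (∷ʳ-injective)
  open import Data.Product as Product using (_×_; _,_; proj₁; proj₂; uncurry)
  open import Data.Sum using (inj₁; inj₂)
  open import Relation.Unary using (Pred; _∈_; _⊆_; _≐_; _∪_; _⊥_)
  open import Relation.Binary.PropositionalEquality using (_≡_; _≢_; refl; sym; trans; cong; cong₂; subst)
  open Enumerations
  open IntegerLemmas

  prefixSum : (ℕ → ℕ) → ℕ → ℕ
  prefixSum b zero = b zero
  prefixSum b (suc s) = b (suc s) ℕ.+ prefixSum b s

  -- A lattice polytope P is represented by the lattice points B s of its dilates s·P, for all
  -- integers s (none for s < 0); the lattice points of s·Pyr(P) are then the (y , w) with 0 ≤ w
  -- and y a lattice point of (s − w)·P.
  Slices : ∀ {N} → (ℤ → Pred (Vec ℤ N) 0ℓ) → ℤ → Pred (Vec ℤ N × ℤ) 0ℓ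
  Slices B s (y , w) = 0ℤ ≤ w × y ∈ B (s - w)

  PyrLattice : ∀ {N} → (ℤ → Pred (Vec ℤ N) 0ℓ) → ℤ → Pred (Vec ℤ (suc N)) 0ℓ
  PyrLattice B s = Image (uncurry _∷ʳ_) (Slices B s)

  module _ {N} (B : ℤ → Pred (Vec ℤ N) 0ℓ) (B-nonneg : ∀ {s y} → y ∈ B s → 0ℤ ≤ s) where

    private
      base : ℤ → Pred (Vec ℤ N × ℤ) 0ℓ
      base s = Image (_, + 0) (B s)

      raised : ℤ → Pred (Vec ℤ N × ℤ) 0ℓ
      raised s = Image (Product.map₂ ℤ.suc) (Slices B s)

      level-resp : ∀ {s s' y} → s ≡ s' → y ∈ B s → y ∈ B s'
      level-resp {y = y} = subst (λ l → y ∈ B l)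

      1+s-[1+w]≡s-w : ∀ s w → (+ 1 + s) - (+ 1 + w) ≡ s - w
      1+s-[1+w]≡s-w = solve-∀

      slices-0 : Slices B (+ 0) ≐ base (+ 0)
      slices-0 = to , λ { (y , y∈B , refl) → 0≤+ 0 , y∈B }
        where
        to : Slices B (+ 0) ⊆ base (+ 0)
        to {y , + zero} (_ , y∈B) = y , y∈B , refl
        to {y , + suc w} (_ , y∈B) with B-nonneg y∈B
        ... | ()

      slices-suc : ∀ s → Slices B (+ suc s) ≐ (base (+ suc s) ∪ raised (+ s))
      slices-suc s = to , from
        where
        to : Slices B (+ suc s) ⊆ base (+ suc s) ∪ raised (+ s)
        to {y , + zero} (_ , y∈B) = inj₁ (y , level-resp (ℤ.+-identityʳ _) y∈B , refl)
        to {y , + suc w} (_ , y∈B) = inj₂ ((y , + w) , (0≤+ w , level-resp (1+s-[1+w]≡s-w (+ s) (+ w)) y∈B) , refl)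
        from : base (+ suc s) ∪ raised (+ s) ⊆ Slices B (+ suc s)
        from (inj₁ (y , y∈B , refl)) = 0≤+ 0 , level-resp (sym (ℤ.+-identityʳ _)) y∈B
        from (inj₂ ((y , w) , (0≤w , y∈B) , refl)) = 0≤-+ (0≤+ 1) 0≤w , level-resp (sym (1+s-[1+w]≡s-w (+ s) w)) y∈B

      base⊥raised : ∀ s t → base s ⊥ raised t
      base⊥raised s t ((y , _ , refl) , ((y' , w) , (0≤w , _) , eq)) = 1+w≢0 0≤w (cong proj₂ eq)
        where
        1+w≢0 : ∀ {w} → 0ℤ ≤ w → ℤ.suc w ≢ + 0
        1+w≢0 (+≤+ _) ()

      raise-injective : ∀ {p q : Vec ℤ N × ℤ} → Product.map₂ ℤ.suc p ≡ Product.map₂ ℤ.suc q → p ≡ q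
      raise-injective {y , w} {y' , w'} eq =
        cong₂ _,_ (cong proj₁ eq) (trans (sym (ℤ.pred-suc w)) (trans (cong ℤ.pred (cong proj₂ eq)) (ℤ.pred-suc w')))

    enum-slices : ∀ {b} → (∀ s → Enumeration (B (+ s)) (b s)) → ∀ s → Enumeration (Slices B (+ s)) (prefixSum b s)
    enum-slices E zero = enum-≐ (Product.swap slices-0) (enum-image (_, + 0) (λ _ _ → cong proj₁) (E 0))
    enum-slices E (suc s) = enum-≐ (Product.swap (slices-suc s))
      (enum-∪ (base⊥raised (+ suc s) (+ s))
        (enum-image (_, + 0) (λ _ _ → cong proj₁) (E (suc s)))
        (enum-image (Product.map₂ ℤ.suc) (λ _ _ → raise-injective) (enum-slices E s)))

    enum-pyrLattice : ∀ {b} → (∀ s → Enumeration (B (+ s)) (b s)) → ∀ s → Enumeration (PyrLattice B (+ s)) (prefixSum b s)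
    enum-pyrLattice E s =
      enum-image (uncurry _∷ʳ_) (λ _ _ eq → uncurry (cong₂ _,_) (∷ʳ-injective _ _ eq)) (enum-slices E s)

    pyrLattice-nonneg : ∀ {s v} → v ∈ PyrLattice B s → 0ℤ ≤ s
    pyrLattice-nonneg {s} ((y , w) , (0≤w , y∈B) , _) = subst (0ℤ ≤_) (s-w+w≡s s w) (0≤-+ (B-nonneg y∈B) 0≤w)
      where
      s-w+w≡s : ∀ s w → s - w + w ≡ s
      s-w+w≡s = solve-∀

module ReeveLattice where

  open import Level using (0ℓ)
  open import Data.Nat using (ℕ; zero; suc; s≤s)
  import Data.Nat as ℕ
  import Data.Nat.Properties as ℕ
  open import Data.Nat.DivMod using (_%_; _/_; m≡m%n+[m/n]*n; m%n<n)
  open import Data.Integer using (ℤ; +_; -[1+_]; 0ℤ; +≤+; +<+; _+_; _-_; _*_; _≤_; _<_)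
  import Data.Integer.Properties as ℤ
  open import Data.Integer.Tactic.RingSolver using (solve-∀)
  open import Data.Fin using (Fin; toℕ; fromℕ<)
  open import Data.Fin.Properties using (toℕ-injective; toℕ<n; toℕ-fromℕ<)
  open import Data.Vec using (Vec; []; _∷_)
  open import Data.Vec.Properties using (∷-injective)
  open import Data.Product as Product using (_×_; _,_; proj₁; proj₂)
  open import Data.Sum using (inj₁; inj₂; [_,_])
  open import Function using (id)
  open import Relation.Unary using (Pred; _∈_; _⊆_; _≐_; _∪_; _⊥_; _⟨×⟩_; U; Empty)
  open import Relation.Binary.PropositionalEquality using (_≡_; refl; sym; trans; cong; cong₂; subst; module ≡-Reasoning)
  open Enumerations
  open IntegerLemmas
  open LatticePyramids

  Point : ℤ → Pred (Vec ℤ 0) 0ℓ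
  Point s _ = 0ℤ ≤ s

  Simplex : ℤ → Pred (Vec ℤ 3) 0ℓ
  Simplex s (a ∷ b ∷ c ∷ []) = 0ℤ ≤ a × 0ℤ ≤ b × 0ℤ ≤ c × 0ℤ ≤ s - a - b - c

  simplex≐pyr³ : ∀ s → Simplex s ≐ PyrLattice (PyrLattice (PyrLattice Point)) s
  simplex≐pyr³ s = to , from
    where
    reorder : ∀ s a b c → s - c - b - a ≡ s - a - b - c
    reorder = solve-∀
    to : Simplex s ⊆ PyrLattice (PyrLattice (PyrLattice Point)) s
    to {a ∷ b ∷ c ∷ []} (0≤a , 0≤b , 0≤c , 0≤rest) =
      _ , (0≤c , (_ , (0≤b , (([] , a) , (0≤a , subst (0ℤ ≤_) (sym (reorder s a b c)) 0≤rest) , refl)) , refl)) , refl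
    from : PyrLattice (PyrLattice (PyrLattice Point)) s ⊆ Simplex s
    from ((_ , c) , (0≤c , ((_ , b) , (0≤b , (([] , a) , (0≤a , 0≤rest) , refl)) , refl)) , refl) =
      0≤a , 0≤b , 0≤c , subst (0ℤ ≤_) (reorder s a b c) 0≤rest

  simplex-nonneg : ∀ {s v} → v ∈ Simplex s → 0ℤ ≤ s
  simplex-nonneg {s} {a ∷ b ∷ c ∷ []} (0≤a , 0≤b , 0≤c , 0≤rest) =
    subst (0ℤ ≤_) (regroup s a b c) (0≤-+ (0≤-+ (0≤-+ 0≤rest 0≤a) 0≤b) 0≤c)
    where
    regroup : ∀ s a b c → s - a - b - c + a + b + c ≡ s
    regroup = solve-∀

  simplexCount : ℕ → ℕ
  simplexCount = prefixSum (prefixSum (prefixSum (λ _ → 1)))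

  enum-simplex : ∀ s → Enumeration (Simplex (+ s)) (simplexCount s)
  enum-simplex s = enum-≐ (Product.swap (simplex≐pyr³ (+ s)))
    (enum-pyrLattice _ (pyrLattice-nonneg _ (pyrLattice-nonneg _ id))
      (enum-pyrLattice _ (pyrLattice-nonneg _ id) (enum-pyrLattice Point id enum-point)) s)
    where
    enum-point : ∀ s → Enumeration (Point (+ s)) 1
    enum-point s = enum-≐ ((λ _ → 0≤+ s) , λ { {[]} _ → refl }) (enum-｛｝ [])

  simplex-empty-below-0 : ∀ n → Empty (Simplex -[1+ n ])
  simplex-empty-below-0 n _ v∈Δ with simplex-nonneg v∈Δ
  ... | ()

  shiftedSimplexCount : ℕ → ℕ
  shiftedSimplexCount (suc (suc s)) = simplexCount s
  shiftedSimplexCount _ = 0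

  enum-shiftedSimplex : ∀ s → Enumeration (Simplex (+ s - + 2)) (shiftedSimplexCount s)
  enum-shiftedSimplex zero = enum-∅ (simplex-empty-below-0 1)
  enum-shiftedSimplex (suc zero) = enum-∅ (simplex-empty-below-0 0)
  enum-shiftedSimplex (suc (suc s)) = enum-simplex s

  -- The barycentric coordinates of (x, y, z) in s·T_m, with respect to the vertices 0, e₁, e₂ and
  -- (1, 1, m) and multiplied by m, are m (s − x − y) + z, m x − z, m y − z and z.
  ReeveLattice : ℕ → ℤ → Pred (Vec ℤ 3) 0ℓ
  ReeveLattice m s (x ∷ y ∷ z ∷ []) = 0ℤ ≤ z × 0ℤ ≤ M * x - z × 0ℤ ≤ M * y - z × 0ℤ ≤ M * (s - x - y) + z
    where
    M : ℤ
    M = + m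

  reeveCount : ℕ → ℕ → ℕ
  reeveCount mm s = simplexCount s ℕ.+ mm ℕ.* shiftedSimplexCount s

  -- From here on the Reeve parameter is m = suc mm.
  module _ (mm : ℕ) where

    private
      M : ℤ
      M = + suc mm

      residue : Fin mm → ℤ
      residue i = + suc (toℕ i)

      residue<M : ∀ i → residue i < M
      residue<M i = +<+ (s≤s (toℕ<n i))

      0≤M : 0ℤ ≤ M
      0≤M = 0≤+ (suc mm)

      0<M : 0ℤ < M
      0<M = +<+ (s≤s ℕ.z≤n)

    -- With z = m a + ρ and 0 ≤ ρ < m, the lattice points of s·T_m with ρ = 0 are the images of
    -- s·Δ₃ under layer₀, and those with ρ = 1 + i are the images of (s − 2)·Δ₃ under layer₁ i.
    layer₀ : Vec ℤ 3 → Vec ℤ 3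
    layer₀ (a ∷ b ∷ c ∷ []) = a + b ∷ a + c ∷ M * a ∷ []

    layer₁ : Fin mm × Vec ℤ 3 → Vec ℤ 3
    layer₁ (i , (a ∷ b ∷ c ∷ [])) = a + b + + 1 ∷ a + c + + 1 ∷ M * a + residue i ∷ []

    layer₀-injective : ∀ {u v} → layer₀ u ≡ layer₀ v → u ≡ v
    layer₀-injective {a ∷ b ∷ c ∷ []} {a' ∷ b' ∷ c' ∷ []} eq
      with ∷-injective eq
    ... | a+b≡ , eq' with ∷-injective eq'
    ... | a+c≡ , eq'' with ℤ.*-cancelˡ-≡ M a a' (proj₁ (∷-injective eq''))
    ... | refl rewrite +-cancelˡ-≡ a b b' a+b≡ | +-cancelˡ-≡ a c c' a+c≡ = refl

    layer₁-injective : ∀ {u v} → layer₁ u ≡ layer₁ v → u ≡ v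
    layer₁-injective {i , (a ∷ b ∷ c ∷ [])} {i' , (a' ∷ b' ∷ c' ∷ [])} eq
      with ∷-injective eq
    ... | a+b+1≡ , eq' with ∷-injective eq'
    ... | a+c+1≡ , eq'' with euclid-unique mm {a} {a'} (0≤+ _) (residue<M i) (0≤+ _) (residue<M i') (proj₁ (∷-injective eq''))
    ... | refl , ρ≡ρ' rewrite toℕ-injective (ℕ.suc-injective (ℤ.+-injective ρ≡ρ'))
                            | +-cancelˡ-≡ a b b' (+-cancelʳ-≡ (+ 1) _ _ a+b+1≡)
                            | +-cancelˡ-≡ a c c' (+-cancelʳ-≡ (+ 1) _ _ a+c+1≡) = refl

    layer₀⊥layer₁ : ∀ {P Q} → Image layer₀ P ⊥ Image layer₁ Q
    layer₀⊥layer₁ ((a ∷ b ∷ c ∷ [] , _ , refl) , ((i , (a' ∷ b' ∷ c' ∷ [])) , _ , eq))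
      with euclid-unique mm {a} {a'} (0≤+ 0) 0<M (0≤+ _) (residue<M i)
             (trans (ℤ.+-identityʳ (M * a)) (sym (proj₁ (∷-injective (proj₂ (∷-injective (proj₂ (∷-injective eq))))))))
    ... | _ , ()

    layer₀-sound : ∀ {s} → Image layer₀ (Simplex s) ⊆ ReeveLattice (suc mm) s
    layer₀-sound {s} ((a ∷ b ∷ c ∷ []) , (0≤a , 0≤b , 0≤c , 0≤rest) , refl) =
      0≤-* 0≤M 0≤a ,
      subst (0ℤ ≤_) (sym (M[a+b]-Ma≡Mb M a b)) (0≤-* 0≤M 0≤b) ,
      subst (0ℤ ≤_) (sym (M[a+b]-Ma≡Mb M a c)) (0≤-* 0≤M 0≤c) ,
      subst (0ℤ ≤_) (sym (coordinate₀ M s a b c)) (0≤-* 0≤M 0≤rest)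
      where
      M[a+b]-Ma≡Mb : ∀ M a b → M * (a + b) - M * a ≡ M * b
      M[a+b]-Ma≡Mb = solve-∀
      coordinate₀ : ∀ M s a b c → M * (s - (a + b) - (a + c)) + M * a ≡ M * (s - a - b - c)
      coordinate₀ = solve-∀

    layer₁-sound : ∀ {s} → Image layer₁ (U ⟨×⟩ Simplex (s - + 2)) ⊆ ReeveLattice (suc mm) s
    layer₁-sound {s} ((i , (a ∷ b ∷ c ∷ [])) , (_ , (0≤a , 0≤b , 0≤c , 0≤rest)) , refl) =
      0≤-+ (0≤-* 0≤M 0≤a) (0≤+ _) ,
      subst (0ℤ ≤_) (sym (coordinate (+ mm) a b I)) (0≤-+ (0≤-* 0≤M 0≤b) 0≤mm-I) ,
      subst (0ℤ ≤_) (sym (coordinate (+ mm) a c I)) (0≤-+ (0≤-* 0≤M 0≤c) 0≤mm-I) ,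
      subst (0ℤ ≤_) (sym (coordinate₀ M s a b c I)) (0≤-+ (0≤-* 0≤M 0≤rest) (0≤+ _))
      where
      I : ℤ
      I = + toℕ i
      0≤mm-I : 0ℤ ≤ + mm - I
      0≤mm-I = ℤ.i≤j⇒0≤j-i (+≤+ (ℕ.<⇒≤ (toℕ<n i)))
      coordinate : ∀ Mm a b I → (+ 1 + Mm) * (a + b + + 1) - ((+ 1 + Mm) * a + (+ 1 + I)) ≡ (+ 1 + Mm) * b + (Mm - I)
      coordinate = solve-∀
      coordinate₀ : ∀ M s a b c I →
        M * (s - (a + b + + 1) - (a + c + + 1)) + (M * a + (+ 1 + I)) ≡ M * (s - + 2 - a - b - c) + (+ 1 + I)
      coordinate₀ = solve-∀

    private
      Layers : ℤ → Pred (Vec ℤ 3) 0ℓ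
      Layers s = Image layer₀ (Simplex s) ∪ Image layer₁ (U ⟨×⟩ Simplex (s - + 2))

      divide : ∀ k → + k ≡ M * + (k / suc mm) + + (k % suc mm)
      divide k = begin
        + k                                          ≡⟨ cong +_ (m≡m%n+[m/n]*n k (suc mm)) ⟩
        + (k % suc mm ℕ.+ k / suc mm ℕ.* suc mm)     ≡⟨ ℤ.pos-+ (k % suc mm) _ ⟩
        + (k % suc mm) + + (k / suc mm ℕ.* suc mm)   ≡⟨ cong (_+_ (+ (k % suc mm))) (ℤ.pos-* (k / suc mm) (suc mm)) ⟩
        + (k % suc mm) + + (k / suc mm) * M          ≡⟨ swap (+ (k % suc mm)) (+ (k / suc mm)) M ⟩
        M * + (k / suc mm) + + (k % suc mm)          ∎
        where
        open ≡-Reasoning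
        swap : ∀ r q M → r + q * M ≡ M * q + r
        swap = solve-∀

      classify₀ : ∀ {s x y} q → ReeveLattice (suc mm) s (x ∷ y ∷ M * + q + + 0 ∷ []) →
        (x ∷ y ∷ M * + q + + 0 ∷ []) ∈ Image layer₀ (Simplex s)
      classify₀ {s} {x} {y} q (_ , p₁ , p₂ , p₃) =
        (Q ∷ x - Q ∷ y - Q ∷ []) , (0≤+ q , below x p₁ , below y p₂ , 0≤rest) ,
        cong₂ _∷_ (Q+[x-Q]≡x Q x) (cong₂ _∷_ (Q+[x-Q]≡x Q y) (cong (_∷ []) (sym (ℤ.+-identityʳ (M * Q)))))
        where
        Q : ℤ
        Q = + q
        Mx-MQ : ∀ M x Q → M * x - (M * Q + + 0) ≡ M * (x - Q) + + 0
        Mx-MQ = solve-∀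
        rest : ∀ M s x y Q → M * (s - x - y) + (M * Q + + 0) ≡ M * (s - Q - (x - Q) - (y - Q)) + + 0
        rest = solve-∀
        Q+[x-Q]≡x : ∀ Q x → Q + (x - Q) ≡ x
        Q+[x-Q]≡x = solve-∀
        below : ∀ x → 0ℤ ≤ M * x - (M * Q + + 0) → 0ℤ ≤ x - Q
        below x p = quotient-nonneg mm (x - Q) (subst (0ℤ ≤_) (Mx-MQ M x Q) p) 0<M
        0≤rest : 0ℤ ≤ s - Q - (x - Q) - (y - Q)
        0≤rest = quotient-nonneg mm _ (subst (0ℤ ≤_) (rest M s x y Q) p₃) 0<M

      classify₁ : ∀ {s x y} q ρ (ρ<mm : ρ ℕ.< mm) → ReeveLattice (suc mm) s (x ∷ y ∷ M * + q + + suc ρ ∷ []) →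
        (x ∷ y ∷ M * + q + + suc ρ ∷ []) ∈ Image layer₁ (U ⟨×⟩ Simplex (s - + 2))
      classify₁ {s} {x} {y} q ρ ρ<mm (_ , p₁ , p₂ , p₃) =
        (fromℕ< ρ<mm , (Q ∷ x - Q - + 1 ∷ y - Q - + 1 ∷ [])) , (_ , (0≤+ q , below x p₁ , below y p₂ , 0≤rest)) ,
        cong₂ _∷_ (Q+[x-Q-1]+1≡x Q x) (cong₂ _∷_ (Q+[x-Q-1]+1≡x Q y)
          (cong (λ r → M * Q + + suc r ∷ []) (toℕ-fromℕ< ρ<mm)))
        where
        Q R : ℤ
        Q = + q
        R = + ρ
        mm-R<M : + mm - R < M
        mm-R<M = ℤ.≤-<-trans (ℤ.i-j≤i (+ mm) R) (+<+ ℕ.≤-refl)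
        Mx-MQ-ρ : ∀ Mm x Q R → (+ 1 + Mm) * x - ((+ 1 + Mm) * Q + (+ 1 + R)) ≡ (+ 1 + Mm) * (x - Q - + 1) + (Mm - R)
        Mx-MQ-ρ = solve-∀
        rest : ∀ M s x y Q R → M * (s - x - y) + (M * Q + (+ 1 + R)) ≡ M * (s - + 2 - Q - (x - Q - + 1) - (y - Q - + 1)) + (+ 1 + R)
        rest = solve-∀
        Q+[x-Q-1]+1≡x : ∀ Q x → Q + (x - Q - + 1) + + 1 ≡ x
        Q+[x-Q-1]+1≡x = solve-∀
        below : ∀ x → 0ℤ ≤ M * x - (M * Q + + suc ρ) → 0ℤ ≤ x - Q - + 1
        below x p = quotient-nonneg mm (x - Q - + 1) (subst (0ℤ ≤_) (Mx-MQ-ρ (+ mm) x Q R) p) mm-R<M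
        0≤rest : 0ℤ ≤ s - + 2 - Q - (x - Q - + 1) - (y - Q - + 1)
        0≤rest = quotient-nonneg mm _ (subst (0ℤ ≤_) (rest M s x y Q R) p₃) (+<+ (s≤s ρ<mm))

      classify : ∀ {s x y z} q ρ → ρ ℕ.< suc mm → z ≡ M * + q + + ρ →
        ReeveLattice (suc mm) s (x ∷ y ∷ z ∷ []) → (x ∷ y ∷ z ∷ []) ∈ Layers s
      classify {s} q zero _ refl p = inj₁ (classify₀ {s} q p)
      classify {s} q (suc ρ) (s≤s ρ<mm) refl p = inj₂ (classify₁ {s} q ρ ρ<mm p)

    reeve≐layers : ∀ s → ReeveLattice (suc mm) s ≐ Layers s
    reeve≐layers s = to , [ layer₀-sound , layer₁-sound ]
      where
      to : ReeveLattice (suc mm) s ⊆ Layers s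
      to {x ∷ y ∷ z ∷ []} p@(+≤+ {n = k} _ , _) = classify (k / suc mm) (k % suc mm) (m%n<n k (suc mm)) (divide k) p

    enum-reeve : ∀ s → Enumeration (ReeveLattice (suc mm) (+ s)) (reeveCount mm s)
    enum-reeve s = enum-≐ (Product.swap (reeve≐layers (+ s)))
      (enum-∪ layer₀⊥layer₁ (enum-image layer₀ (λ _ _ → layer₀-injective) (enum-simplex s))
                            (enum-image layer₁ (λ _ _ → layer₁-injective) (enum-⟨×⟩ enum-U (enum-shiftedSimplex s))))

    reeve-nonneg : ∀ {s v} → v ∈ ReeveLattice (suc mm) s → 0ℤ ≤ s
    reeve-nonneg {s} {x ∷ y ∷ z ∷ []} (p₀ , p₁ , p₂ , p₃) =
      quotient-nonneg mm s (subst (0ℤ ≤_) (total M s x y z) (0≤-+ (0≤-+ (0≤-+ p₃ p₁) p₂) p₀)) 0<M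
      where
      total : ∀ M s x y z → M * (s - x - y) + z + (M * x - z) + (M * y - z) + z ≡ M * s + + 0
      total = solve-∀

module CubeLattice where

  open import Level using (0ℓ)
  open import Data.Nat using (ℕ; zero; suc; s≤s; _^_)
  open import Data.Integer using (ℤ; +_; 0ℤ; +≤+; _≤_)
  import Data.Integer.Properties as ℤ
  open import Data.Fin using (Fin; toℕ; fromℕ<)
  import Data.Fin as Fin
  open import Data.Fin.Properties using (toℕ-injective; toℕ<n; toℕ-fromℕ<)
  import Data.Nat.Properties as ℕ
  open import Data.Vec using (Vec; []; _∷_; lookup)
  open import Data.Vec.Properties using (∷-injective)
  open import Data.Product using (_×_; _,_; uncurry)
  open import Relation.Unary using (Pred; _∈_; _⊆_; _⟨×⟩_)
  open import Relation.Binary.PropositionalEquality using (refl; cong; cong₂)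
  open Enumerations
  open IntegerLemmas

  Interval : ℕ → Pred ℤ 0ℓ
  Interval K x = 0ℤ ≤ x × x ≤ + K

  CubeLattice : ℕ → (n : ℕ) → Pred (Vec ℤ n) 0ℓ
  CubeLattice K n z = ∀ i → lookup z i ∈ Interval K

  enum-interval : ∀ K → Enumeration (Interval K) (suc K)
  enum-interval K = (λ i → + toℕ i) , (λ eq → toℕ-injective (ℤ.+-injective eq)) ,
                    (λ i → 0≤+ _ , +≤+ (ℕ.≤-pred (toℕ<n i))) ,
                    λ { x (+≤+ {n = j} _ , +≤+ j≤K) → fromℕ< (s≤s j≤K) , cong +_ (toℕ-fromℕ< (s≤s j≤K)) }

  enum-cube : ∀ K n → Enumeration (CubeLattice K n) (suc K ^ n)
  enum-cube K zero = enum-≐ ((λ { refl () }) , λ { {[]} _ → refl }) (enum-｛｝ [])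
  enum-cube K (suc n) = enum-≐ (to , from)
    (enum-image (uncurry _∷_) (λ _ _ eq → uncurry (cong₂ _,_) (∷-injective eq)) (enum-⟨×⟩ (enum-interval K) (enum-cube K n)))
    where
    to : Image (uncurry _∷_) (Interval K ⟨×⟩ CubeLattice K n) ⊆ CubeLattice K (suc n)
    to ((x , z) , (x∈I , z∈C) , refl) Fin.zero = x∈I
    to ((x , z) , (x∈I , z∈C) , refl) (Fin.suc i) = z∈C i
    from : CubeLattice K (suc n) ⊆ Image (uncurry _∷_) (Interval K ⟨×⟩ CubeLattice K n)
    from {x ∷ z} x∷z∈C = (x , z) , (x∷z∈C Fin.zero , λ i → x∷z∈C (Fin.suc i)) , refl

module LatticeCounts where

  open import Level using (0ℓ)
  open import Data.Nat using (ℕ; zero; suc; _!)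
  import Data.Nat as ℕ
  import Data.Nat.Properties as ℕ
  open import Data.Integer using (ℤ; +_; 0ℤ; _+_; _-_; _*_; _≤_)
  import Data.Integer.Properties as ℤ
  open import Data.Integer.Tactic.RingSolver using (solve-∀)
  open import Data.Vec using (Vec)
  open import Relation.Unary using (Pred; _∈_)
  open import Relation.Binary.PropositionalEquality using (_≡_; refl; trans; cong; cong₂; module ≡-Reasoning)
  open Enumerations
  open LatticePyramids
  open ReeveLattice

  open ≡-Reasoning

  rising : ℕ → ℤ → ℤ
  rising zero T = + 1
  rising (suc k) T = rising k T * (T + + suc k)

  rising-shift : ∀ k T → rising (suc k) T ≡ (+ 1 + T) * rising k (+ 1 + T)
  rising-shift zero T = shift T
    where
    shift : ∀ T → + 1 * (T + + 1) ≡ (+ 1 + T) * + 1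
    shift = solve-∀
  rising-shift (suc k) T = begin
    rising (suc k) T * (T + + suc (suc k))                     ≡⟨ cong (_* (T + + suc (suc k))) (rising-shift k T) ⟩
    (+ 1 + T) * rising k (+ 1 + T) * (T + + suc (suc k))       ≡⟨ shift T (rising k (+ 1 + T)) (+ k) ⟩
    (+ 1 + T) * (rising k (+ 1 + T) * ((+ 1 + T) + + suc k))  ∎
    where
    shift : ∀ T X K → (+ 1 + T) * X * (T + (+ 2 + K)) ≡ (+ 1 + T) * (X * ((+ 1 + T) + (+ 1 + K)))
    shift = solve-∀

  private
    factorial-suc : ∀ k n → + (suc k ! ℕ.* n) ≡ + suc k * + (k ! ℕ.* n)
    factorial-suc k n = trans (cong +_ (ℕ.*-assoc (suc k) (k !) n)) (ℤ.pos-* (suc k) (k ! ℕ.* n))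

    times-sum : ∀ c a b → + (c ℕ.* (a ℕ.+ b)) ≡ + (c ℕ.* a) + + (c ℕ.* b)
    times-sum c a b = trans (cong +_ (ℕ.*-distribˡ-+ c a b)) (ℤ.pos-+ (c ℕ.* a) (c ℕ.* b))

  prefixSum-rising : ∀ k {b} → (∀ s → + (k ! ℕ.* b s) ≡ rising k (+ s)) →
    ∀ s → + (suc k ! ℕ.* prefixSum b s) ≡ rising (suc k) (+ s)
  prefixSum-rising k {b} hyp zero = begin
    + (suc k ! ℕ.* b 0)              ≡⟨ factorial-suc k (b 0) ⟩
    + suc k * + (k ! ℕ.* b 0)        ≡⟨ cong (+ suc k *_) (hyp 0) ⟩
    + suc k * rising k (+ 0)         ≡⟨ swap (+ k) (rising k (+ 0)) ⟩
    rising k (+ 0) * (+ 0 + + suc k) ∎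
    where
    swap : ∀ K X → (+ 1 + K) * X ≡ X * (+ 0 + (+ 1 + K))
    swap = solve-∀
  prefixSum-rising k {b} hyp (suc s) = begin
    + (suc k ! ℕ.* (b (suc s) ℕ.+ prefixSum b s))
      ≡⟨ times-sum (suc k !) (b (suc s)) (prefixSum b s) ⟩
    + (suc k ! ℕ.* b (suc s)) + + (suc k ! ℕ.* prefixSum b s)
      ≡⟨ cong₂ _+_ (factorial-suc k (b (suc s))) (prefixSum-rising k hyp s) ⟩
    + suc k * + (k ! ℕ.* b (suc s)) + rising (suc k) (+ s)
      ≡⟨ cong₂ _+_ (cong (+ suc k *_) (hyp (suc s))) (rising-shift k (+ s)) ⟩
    + suc k * rising k (+ suc s) + (+ 1 + + s) * rising k (+ suc s)
      ≡⟨ collect (+ k) (+ s) (rising k (+ suc s)) ⟩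
    rising k (+ suc s) * (+ suc s + + suc k)
      ∎
    where
    collect : ∀ K S X → (+ 1 + K) * X + (+ 1 + S) * X ≡ X * ((+ 1 + S) + (+ 1 + K))
    collect = solve-∀

  simplexCount-formula : ∀ s → + (3 ! ℕ.* simplexCount s) ≡ rising 3 (+ s)
  simplexCount-formula = prefixSum-rising 2 (prefixSum-rising 1 (prefixSum-rising 0 λ _ → refl))

  shiftedSimplexCount-formula : ∀ s → + (3 ! ℕ.* shiftedSimplexCount s) ≡ rising 3 (+ s - + 2)
  shiftedSimplexCount-formula zero = refl
  shiftedSimplexCount-formula (suc zero) = refl
  shiftedSimplexCount-formula (suc (suc s)) = simplexCount-formula s

  quadraticFactor : ℤ → ℕ → ℤ → ℤ
  quadraticFactor M r T = M * T * T - M * T + + 2 * (+ r + + 3) * T + (+ r + + 2) * (+ r + + 3)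

  reeveCount-formula : ∀ mm s → + (3 ! ℕ.* reeveCount mm s) ≡ rising 1 (+ s) * quadraticFactor (+ suc mm) 0 (+ s)
  reeveCount-formula mm s = begin
    + (3 ! ℕ.* (simplexCount s ℕ.+ mm ℕ.* shiftedSimplexCount s))
      ≡⟨ times-sum (3 !) (simplexCount s) _ ⟩
    + (3 ! ℕ.* simplexCount s) + + (3 ! ℕ.* (mm ℕ.* shiftedSimplexCount s))
      ≡⟨ cong (_+_ (+ (3 ! ℕ.* simplexCount s))) (pull-out mm (shiftedSimplexCount s)) ⟩
    + (3 ! ℕ.* simplexCount s) + + mm * + (3 ! ℕ.* shiftedSimplexCount s)
      ≡⟨ cong₂ (λ A B → A + + mm * B) (simplexCount-formula s) (shiftedSimplexCount-formula s) ⟩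
    rising 3 (+ s) + + mm * rising 3 (+ s - + 2)
      ≡⟨ factor (+ mm) (+ s) ⟩
    rising 1 (+ s) * quadraticFactor (+ suc mm) 0 (+ s)
      ∎
    where
    pull-out : ∀ a b → + (3 ! ℕ.* (a ℕ.* b)) ≡ + a * + (3 ! ℕ.* b)
    pull-out a b = trans (cong +_ (ℕ.*-comm (3 !) (a ℕ.* b))) (trans (cong +_ (ℕ.*-assoc a b (3 !)))
                     (trans (ℤ.pos-* a (b ℕ.* 3 !)) (cong (λ n → + a * + n) (ℕ.*-comm b (3 !)))))
    factor : ∀ Mm S → + 1 * (S + + 1) * (S + + 2) * (S + + 3) + Mm * (+ 1 * (S - + 2 + + 1) * (S - + 2 + + 2) * (S - + 2 + + 3)) ≡
      + 1 * (S + + 1) * ((+ 1 + Mm) * S * S - (+ 1 + Mm) * S + + 2 * (+ 0 + + 3) * S + (+ 0 + + 2) * (+ 0 + + 3))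
    factor = solve-∀

  PyrReeveLattice : ℕ → (r : ℕ) → ℤ → Pred (Vec ℤ (r ℕ.+ 3)) 0ℓ
  PyrReeveLattice m zero = ReeveLattice m
  PyrReeveLattice m (suc r) = PyrLattice (PyrReeveLattice m r)

  pyrReeveCount : ℕ → ℕ → ℕ → ℕ
  pyrReeveCount mm zero = reeveCount mm
  pyrReeveCount mm (suc r) = prefixSum (pyrReeveCount mm r)

  pyrReeve-nonneg : ∀ mm r {s v} → v ∈ PyrReeveLattice (suc mm) r s → 0ℤ ≤ s
  pyrReeve-nonneg mm zero = reeve-nonneg mm
  pyrReeve-nonneg mm (suc r) = pyrLattice-nonneg _ (pyrReeve-nonneg mm r)

  enum-pyrReeve : ∀ mm r s → Enumeration (PyrReeveLattice (suc mm) r (+ s)) (pyrReeveCount mm r s)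
  enum-pyrReeve mm zero = enum-reeve mm
  enum-pyrReeve mm (suc r) = enum-pyrLattice _ (pyrReeve-nonneg mm r) (enum-pyrReeve mm r)

  pyrReeveCount-formula : ∀ mm r t →
    + ((r ℕ.+ 3) ! ℕ.* pyrReeveCount mm r t) ≡ rising (suc r) (+ t) * quadraticFactor (+ suc mm) r (+ t)
  pyrReeveCount-formula mm zero t = reeveCount-formula mm t
  pyrReeveCount-formula mm (suc r) zero = begin
    + (suc (r ℕ.+ 3) ! ℕ.* pyrReeveCount mm r 0)
      ≡⟨ factorial-suc (r ℕ.+ 3) _ ⟩
    + suc (r ℕ.+ 3) * + ((r ℕ.+ 3) ! ℕ.* pyrReeveCount mm r 0)
      ≡⟨ cong (+ suc (r ℕ.+ 3) *_) (pyrReeveCount-formula mm r 0) ⟩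
    + suc (r ℕ.+ 3) * (rising (suc r) (+ 0) * quadraticFactor M r (+ 0))
      ≡⟨ at-0 (rising (suc r) (+ 0)) (+ r) M ⟩
    rising (suc (suc r)) (+ 0) * quadraticFactor M (suc r) (+ 0)
      ∎
    where
    M : ℤ
    M = + suc mm
    at-0 : ∀ X R M →
      (+ 1 + (R + + 3)) * (X * (M * + 0 * + 0 - M * + 0 + + 2 * (R + + 3) * + 0 + (R + + 2) * (R + + 3))) ≡
      X * (+ 0 + (+ 2 + R)) * (M * + 0 * + 0 - M * + 0 + + 2 * ((+ 1 + R) + + 3) * + 0 + ((+ 1 + R) + + 2) * ((+ 1 + R) + + 3))
    at-0 = solve-∀
  pyrReeveCount-formula mm (suc r) (suc t) = begin
    + (F ℕ.* (pyrReeveCount mm r (suc t) ℕ.+ pyrReeveCount mm (suc r) t))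
      ≡⟨ times-sum F (pyrReeveCount mm r (suc t)) _ ⟩
    + (F ℕ.* pyrReeveCount mm r (suc t)) + + (F ℕ.* pyrReeveCount mm (suc r) t)
      ≡⟨ cong₂ _+_ (factorial-suc (r ℕ.+ 3) _) (pyrReeveCount-formula mm (suc r) t) ⟩
    + suc (r ℕ.+ 3) * + ((r ℕ.+ 3) ! ℕ.* pyrReeveCount mm r (suc t)) + rising (suc (suc r)) (+ t) * quadraticFactor M (suc r) (+ t)
      ≡⟨ cong₂ _+_ (cong (+ suc (r ℕ.+ 3) *_) (pyrReeveCount-formula mm r (suc t)))
                   (cong (_* quadraticFactor M (suc r) (+ t)) (rising-shift (suc r) (+ t))) ⟩
    + suc (r ℕ.+ 3) * (rising (suc r) (+ suc t) * quadraticFactor M r (+ suc t)) +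
      (+ 1 + + t) * rising (suc r) (+ suc t) * quadraticFactor M (suc r) (+ t)
      ≡⟨ step (rising (suc r) (+ suc t)) (+ r) M (+ t) ⟩
    rising (suc (suc r)) (+ suc t) * quadraticFactor M (suc r) (+ suc t)
      ∎
    where
    M : ℤ
    M = + suc mm
    F : ℕ
    F = suc (r ℕ.+ 3) !
    step : ∀ X R M T →
      (+ 1 + (R + + 3)) * (X * (M * (+ 1 + T) * (+ 1 + T) - M * (+ 1 + T) + + 2 * (R + + 3) * (+ 1 + T) + (R + + 2) * (R + + 3))) +
      (+ 1 + T) * X * (M * T * T - M * T + + 2 * ((+ 1 + R) + + 3) * T + ((+ 1 + R) + + 2) * ((+ 1 + R) + + 3)) ≡
      X * ((+ 1 + T) + (+ 2 + R)) *
        (M * (+ 1 + T) * (+ 1 + T) - M * (+ 1 + T) + + 2 * ((+ 1 + R) + + 3) * (+ 1 + T) + ((+ 1 + R) + + 2) * ((+ 1 + R) + + 3))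
    step = solve-∀

module RationalEmbedding where

  open import Data.Nat using (ℕ; suc; z≤n; s≤s)
  open import Data.Integer as ℤ using (ℤ; +_; +<+)
  import Data.Integer.Properties as ℤ
  open import Data.Integer.Tactic.RingSolver using (solve-∀)
  open import Data.Rational as ℚ using (ℚ; 0ℚ; 1ℚ; toℚᵘ)
  import Data.Rational.Properties as ℚ
  open import Data.Rational.Unnormalised as ℚᵘ using (ℚᵘ; mkℚᵘ; *≡*; *≤*; *<*)
  import Data.Rational.Unnormalised.Properties as ℚᵘ
  open import Relation.Binary.PropositionalEquality using (_≡_; refl; sym; trans; cong; subst₂)
  open import Defs using (ℤ→ℚ)

  private
    embed : ℤ → ℚᵘ
    embed z = mkℚᵘ z 0

    toℚᵘ-ℤ→ℚ : ∀ z → toℚᵘ (ℤ→ℚ z) ℚᵘ.≃ embed z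
    toℚᵘ-ℤ→ℚ z = ℚ.toℚᵘ-fromℚᵘ (embed z)

    open ℚᵘ.≃-Reasoning

  ℤ→ℚ-+ : ∀ a b → ℤ→ℚ (a ℤ.+ b) ≡ ℤ→ℚ a ℚ.+ ℤ→ℚ b
  ℤ→ℚ-+ a b = ℚ.toℚᵘ-injective (begin
    toℚᵘ (ℤ→ℚ (a ℤ.+ b))                ≈⟨ toℚᵘ-ℤ→ℚ (a ℤ.+ b) ⟩
    embed (a ℤ.+ b)                      ≈⟨ *≡* (lemma a b) ⟩
    embed a ℚᵘ.+ embed b                 ≈⟨ ℚᵘ.+-cong (toℚᵘ-ℤ→ℚ a) (toℚᵘ-ℤ→ℚ b) ⟨
    toℚᵘ (ℤ→ℚ a) ℚᵘ.+ toℚᵘ (ℤ→ℚ b)     ≈⟨ ℚ.toℚᵘ-homo-+ (ℤ→ℚ a) (ℤ→ℚ b) ⟨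
    toℚᵘ (ℤ→ℚ a ℚ.+ ℤ→ℚ b)             ∎)
    where
    lemma : ∀ a b → (a ℤ.+ b) ℤ.* + 1 ≡ (a ℤ.* + 1 ℤ.+ b ℤ.* + 1) ℤ.* + 1
    lemma = solve-∀

  ℤ→ℚ-* : ∀ a b → ℤ→ℚ (a ℤ.* b) ≡ ℤ→ℚ a ℚ.* ℤ→ℚ b
  ℤ→ℚ-* a b = ℚ.toℚᵘ-injective (begin
    toℚᵘ (ℤ→ℚ (a ℤ.* b))                ≈⟨ toℚᵘ-ℤ→ℚ (a ℤ.* b) ⟩
    embed a ℚᵘ.* embed b                 ≈⟨ ℚᵘ.*-cong (toℚᵘ-ℤ→ℚ a) (toℚᵘ-ℤ→ℚ b) ⟨
    toℚᵘ (ℤ→ℚ a) ℚᵘ.* toℚᵘ (ℤ→ℚ b)     ≈⟨ ℚ.toℚᵘ-homo-* (ℤ→ℚ a) (ℤ→ℚ b) ⟨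
    toℚᵘ (ℤ→ℚ a ℚ.* ℤ→ℚ b)             ∎)

  ℤ→ℚ-neg : ∀ a → ℤ→ℚ (ℤ.- a) ≡ ℚ.- ℤ→ℚ a
  ℤ→ℚ-neg a = ℚ.toℚᵘ-injective (begin
    toℚᵘ (ℤ→ℚ (ℤ.- a))   ≈⟨ toℚᵘ-ℤ→ℚ (ℤ.- a) ⟩
    ℚᵘ.- embed a          ≈⟨ ℚᵘ.-‿cong (toℚᵘ-ℤ→ℚ a) ⟨
    ℚᵘ.- toℚᵘ (ℤ→ℚ a)    ≈⟨ ℚ.toℚᵘ-homo‿- (ℤ→ℚ a) ⟨
    toℚᵘ (ℚ.- ℤ→ℚ a)     ∎)

  ℤ→ℚ-minus : ∀ a b → ℤ→ℚ (a ℤ.- b) ≡ ℤ→ℚ a ℚ.- ℤ→ℚ b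
  ℤ→ℚ-minus a b rewrite ℤ→ℚ-+ a (ℤ.- b) | ℤ→ℚ-neg b = refl

  ℤ→ℚ-mono-≤ : ∀ {a b} → a ℤ.≤ b → ℤ→ℚ a ℚ.≤ ℤ→ℚ b
  ℤ→ℚ-mono-≤ {a} {b} a≤b = ℚ.toℚᵘ-cancel-≤
    (ℚᵘ.≤-respˡ-≃ (ℚᵘ.≃-sym (toℚᵘ-ℤ→ℚ a)) (ℚᵘ.≤-respʳ-≃ (ℚᵘ.≃-sym (toℚᵘ-ℤ→ℚ b))
      (*≤* (subst₂ ℤ._≤_ (sym (ℤ.*-identityʳ a)) (sym (ℤ.*-identityʳ b)) a≤b))))

  ℤ→ℚ-cancel-≤ : ∀ {a b} → ℤ→ℚ a ℚ.≤ ℤ→ℚ b → a ℤ.≤ b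
  ℤ→ℚ-cancel-≤ {a} {b} ιa≤ιb
    with ℚᵘ.≤-respˡ-≃ (toℚᵘ-ℤ→ℚ a) (ℚᵘ.≤-respʳ-≃ (toℚᵘ-ℤ→ℚ b) (ℚ.toℚᵘ-mono-≤ ιa≤ιb))
  ... | *≤* a*1≤b*1 = subst₂ ℤ._≤_ (ℤ.*-identityʳ a) (ℤ.*-identityʳ b) a*1≤b*1

  ℤ→ℚ-mono-< : ∀ {a b} → a ℤ.< b → ℤ→ℚ a ℚ.< ℤ→ℚ b
  ℤ→ℚ-mono-< {a} {b} a<b = ℚ.toℚᵘ-cancel-<
    (ℚᵘ.<-respˡ-≃ (ℚᵘ.≃-sym (toℚᵘ-ℤ→ℚ a)) (ℚᵘ.<-respʳ-≃ (ℚᵘ.≃-sym (toℚᵘ-ℤ→ℚ b))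
      (*<* (subst₂ ℤ._<_ (sym (ℤ.*-identityʳ a)) (sym (ℤ.*-identityʳ b)) a<b))))

  0≤-*ℚ : ∀ {a b} → 0ℚ ℚ.≤ a → 0ℚ ℚ.≤ b → 0ℚ ℚ.≤ a ℚ.* b
  0≤-*ℚ {a} {b} 0≤a 0≤b =
    ℚ.nonNegative⁻¹ _ {{ℚ.nonNeg*nonNeg⇒nonNeg a {{ℚ.nonNegative 0≤a}} b {{ℚ.nonNegative 0≤b}}}}

  module Reciprocal (k : ℕ) where

    τ : ℚ
    τ = ℤ→ℚ (+ suc k)

    0<τ : 0ℚ ℚ.< τ
    0<τ = ℤ→ℚ-mono-< (+<+ {0} {suc k} (s≤s z≤n))

    instance
      τ≢0 : ℚ.NonZero τ
      τ≢0 = ℚ.>-nonZero 0<τ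

    τ⁻¹ : ℚ
    τ⁻¹ = ℚ.1/ τ

    τ*τ⁻¹≡1 : τ ℚ.* τ⁻¹ ≡ 1ℚ
    τ*τ⁻¹≡1 = ℚ.*-inverseʳ τ

    τ⁻¹*τ≡1 : τ⁻¹ ℚ.* τ ≡ 1ℚ
    τ⁻¹*τ≡1 = ℚ.*-inverseˡ τ

    τ⁻¹*[τ*q]≡q : ∀ q → τ⁻¹ ℚ.* (τ ℚ.* q) ≡ q
    τ⁻¹*[τ*q]≡q q = trans (sym (ℚ.*-assoc τ⁻¹ τ q)) (trans (cong (ℚ._* q) τ⁻¹*τ≡1) (ℚ.*-identityˡ q))

    0<τ⁻¹ : 0ℚ ℚ.< τ⁻¹
    0<τ⁻¹ = ℚ.positive⁻¹ τ⁻¹ {{ℚ.1/pos⇒pos τ {{ℚ.positive 0<τ}}}}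

    0≤τ : 0ℚ ℚ.≤ τ
    0≤τ = ℚ.<⇒≤ 0<τ

    0≤τ⁻¹ : 0ℚ ℚ.≤ τ⁻¹
    0≤τ⁻¹ = ℚ.<⇒≤ 0<τ⁻¹

module ConvexHulls where

  open import Level using (0ℓ)
  open import Data.Nat using (zero; suc)
  open import Data.Integer using (ℤ; +_)
  open import Data.Rational using (ℚ; 0ℚ; 1ℚ; _+_; _*_; _-_; _≤_)
  import Data.Rational.Properties as ℚ
  open import Data.Rational.Solver using (module +-*-Solver)
  open import Data.Vec using (Vec; []; _∷_; _∷ʳ_; map; zipWith; replicate; tabulate; lookup; initLast)
  open import Data.Vec.Properties using (tabulate-cong; tabulate∘lookup; lookup∘tabulate; lookup-zipWith; lookup-map; map-∷ʳ; ∷ʳ-injective)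
  open import Data.Vec.Relation.Unary.All using (All; []; _∷_)
  open import Data.Product using (∃; _×_; _,_)
  open import Function using (_⇔_; mk⇔)
  open import Relation.Unary using (Pred)
  open import Relation.Binary.PropositionalEquality using (_≡_; refl; sym; trans; cong; cong₂; module ≡-Reasoning)
  open import Defs using (ℤ→ℚ; sumℚ; lincomb; pyr)

  infixl 6 _⊕_
  _⊕_ : ∀ {N} → Vec ℚ N → Vec ℚ N → Vec ℚ N
  _⊕_ = zipWith _+_

  infixr 7 _•_
  _•_ : ∀ {N} → ℚ → Vec ℤ N → Vec ℚ N
  a • v = map (λ z → a * ℤ→ℚ z) v

  zeros : ∀ {N} → Vec ℚ N
  zeros = tabulate (λ _ → 0ℚ)

  private
    ⊕-identityˡ : ∀ {N} (v : Vec ℚ N) → zeros ⊕ v ≡ v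
    ⊕-identityˡ [] = refl
    ⊕-identityˡ (x ∷ v) = cong₂ _∷_ (ℚ.+-identityˡ x) (⊕-identityˡ v)

    ⊕-identityʳ : ∀ {N} (v : Vec ℚ N) → v ⊕ zeros ≡ v
    ⊕-identityʳ [] = refl
    ⊕-identityʳ (x ∷ v) = cong₂ _∷_ (ℚ.+-identityʳ x) (⊕-identityʳ v)

    ⊕-assoc : ∀ {N} (u v w : Vec ℚ N) → (u ⊕ v) ⊕ w ≡ u ⊕ (v ⊕ w)
    ⊕-assoc [] [] [] = refl
    ⊕-assoc (a ∷ u) (b ∷ v) (c ∷ w) = cong₂ _∷_ (ℚ.+-assoc a b c) (⊕-assoc u v w)

    ⊕-∷ʳ : ∀ {N} (u v : Vec ℚ N) x y → (u ∷ʳ x) ⊕ (v ∷ʳ y) ≡ (u ⊕ v) ∷ʳ (x + y)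
    ⊕-∷ʳ [] [] x y = refl
    ⊕-∷ʳ (a ∷ u) (b ∷ v) x y = cong ((a + b) ∷_) (⊕-∷ʳ u v x y)

    zeros-∷ʳ : ∀ N → zeros {suc N} ≡ zeros {N} ∷ʳ 0ℚ
    zeros-∷ʳ zero = refl
    zeros-∷ʳ (suc N) = cong (0ℚ ∷_) (zeros-∷ʳ N)

    •-zeros : ∀ {N} a → a • replicate N (+ 0) ≡ zeros
    •-zeros {zero} a = refl
    •-zeros {suc N} a = cong₂ _∷_ (ℚ.*-zeroʳ a) (•-zeros a)

    scale-⊕ : ∀ {N} s (u v : Vec ℚ N) → map (s *_) (u ⊕ v) ≡ map (s *_) u ⊕ map (s *_) v
    scale-⊕ s [] [] = refl
    scale-⊕ s (a ∷ u) (b ∷ v) = cong₂ _∷_ (ℚ.*-distribˡ-+ s a b) (scale-⊕ s u v)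

    scale-• : ∀ {N} s a (v : Vec ℤ N) → map (s *_) (a • v) ≡ (s * a) • v
    scale-• s a [] = refl
    scale-• s a (z ∷ v) = cong₂ _∷_ (sym (ℚ.*-assoc s a (ℤ→ℚ z))) (scale-• s a v)

    scale-zeros : ∀ {N} s → map (s *_) (zeros {N}) ≡ zeros
    scale-zeros {zero} s = refl
    scale-zeros {suc N} s = cong₂ _∷_ (ℚ.*-zeroʳ s) (scale-zeros s)

  lincomb-∷ : ∀ {k N} a (c : Vec ℚ k) (v : Vec ℤ N) V → lincomb (a ∷ c) (v ∷ V) ≡ a • v ⊕ lincomb c V
  lincomb-∷ a c v V = trans (tabulate-cong coordinate) (tabulate∘lookup (a • v ⊕ lincomb c V))
    where
    coordinate : ∀ j → a * ℤ→ℚ (lookup v j) + sumℚ (tabulate (λ i → lookup c i * ℤ→ℚ (lookup (lookup V i) j)))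
                     ≡ lookup (a • v ⊕ lincomb c V) j
    coordinate j = sym (trans (lookup-zipWith _+_ j (a • v) (lincomb c V))
                              (cong₂ _+_ (lookup-map j _ v) (lookup∘tabulate _ j)))

  lincomb-scale : ∀ {k N} s (c : Vec ℚ k) (V : Vec (Vec ℤ N) k) → lincomb (map (s *_) c) V ≡ map (s *_) (lincomb c V)
  lincomb-scale s [] [] = sym (scale-zeros s)
  lincomb-scale s (a ∷ c) (v ∷ V) = begin
    lincomb (s * a ∷ map (s *_) c) (v ∷ V)          ≡⟨ lincomb-∷ (s * a) (map (s *_) c) v V ⟩
    (s * a) • v ⊕ lincomb (map (s *_) c) V          ≡⟨ cong₂ _⊕_ (sym (scale-• s a v)) (lincomb-scale s c V) ⟩
    map (s *_) (a • v) ⊕ map (s *_) (lincomb c V)   ≡⟨ scale-⊕ s (a • v) (lincomb c V) ⟨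
    map (s *_) (a • v ⊕ lincomb c V)                ≡⟨ cong (map (s *_)) (lincomb-∷ a c v V) ⟨
    map (s *_) (lincomb (a ∷ c) (v ∷ V))            ∎
    where open ≡-Reasoning

  private
    lincomb-∷ʳ : ∀ {k N} (c : Vec ℚ k) (V : Vec (Vec ℤ N) k) w u → lincomb (c ∷ʳ w) (V ∷ʳ u) ≡ lincomb c V ⊕ w • u
    lincomb-∷ʳ [] [] w u = trans (lincomb-∷ w [] u []) (trans (⊕-identityʳ (w • u)) (sym (⊕-identityˡ (w • u))))
    lincomb-∷ʳ (a ∷ c) (v ∷ V) w u = begin
      lincomb (a ∷ (c ∷ʳ w)) (v ∷ (V ∷ʳ u)) ≡⟨ lincomb-∷ a (c ∷ʳ w) v (V ∷ʳ u) ⟩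
      a • v ⊕ lincomb (c ∷ʳ w) (V ∷ʳ u)    ≡⟨ cong (a • v ⊕_) (lincomb-∷ʳ c V w u) ⟩
      a • v ⊕ (lincomb c V ⊕ w • u)        ≡⟨ ⊕-assoc (a • v) (lincomb c V) (w • u) ⟨
      (a • v ⊕ lincomb c V) ⊕ w • u        ≡⟨ cong (_⊕ w • u) (lincomb-∷ a c v V) ⟨
      lincomb (a ∷ c) (v ∷ V) ⊕ w • u      ∎
      where open ≡-Reasoning

    lincomb-extend : ∀ {k N} (c : Vec ℚ k) (V : Vec (Vec ℤ N) k) → lincomb c (map (_∷ʳ + 0) V) ≡ lincomb c V ∷ʳ 0ℚ
    lincomb-extend {N = N} [] [] = zeros-∷ʳ N
    lincomb-extend (a ∷ c) (v ∷ V) = begin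
      lincomb (a ∷ c) (map (_∷ʳ + 0) (v ∷ V))
        ≡⟨ lincomb-∷ a c (v ∷ʳ + 0) (map (_∷ʳ + 0) V) ⟩
      a • (v ∷ʳ + 0) ⊕ lincomb c (map (_∷ʳ + 0) V)
        ≡⟨ cong₂ _⊕_ (map-∷ʳ _ (+ 0) v) (lincomb-extend c V) ⟩
      (a • v ∷ʳ a * 0ℚ) ⊕ (lincomb c V ∷ʳ 0ℚ)
        ≡⟨ ⊕-∷ʳ (a • v) (lincomb c V) (a * 0ℚ) 0ℚ ⟩
      (a • v ⊕ lincomb c V) ∷ʳ (a * 0ℚ + 0ℚ)
        ≡⟨ cong₂ _∷ʳ_ (sym (lincomb-∷ a c v V)) (trans (ℚ.+-identityʳ _) (ℚ.*-zeroʳ a)) ⟩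
      lincomb (a ∷ c) (v ∷ V) ∷ʳ 0ℚ
        ∎
      where open ≡-Reasoning

  lincomb-pyr : ∀ {k N} (c : Vec ℚ k) (V : Vec (Vec ℤ N) k) w → lincomb (c ∷ʳ w) (pyr V) ≡ lincomb c V ∷ʳ w
  lincomb-pyr {N = N} c V w = begin
    lincomb (c ∷ʳ w) (map (_∷ʳ + 0) V ∷ʳ (replicate N (+ 0) ∷ʳ + 1))
      ≡⟨ lincomb-∷ʳ c (map (_∷ʳ + 0) V) w _ ⟩
    lincomb c (map (_∷ʳ + 0) V) ⊕ w • (replicate N (+ 0) ∷ʳ + 1)
      ≡⟨ cong₂ _⊕_ (lincomb-extend c V) (map-∷ʳ _ (+ 1) (replicate N (+ 0))) ⟩
    (lincomb c V ∷ʳ 0ℚ) ⊕ (w • replicate N (+ 0) ∷ʳ w * 1ℚ)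
      ≡⟨ ⊕-∷ʳ (lincomb c V) _ 0ℚ (w * 1ℚ) ⟩
    (lincomb c V ⊕ w • replicate N (+ 0)) ∷ʳ (0ℚ + w * 1ℚ)
      ≡⟨ cong₂ _∷ʳ_ (trans (cong (lincomb c V ⊕_) (•-zeros w)) (⊕-identityʳ (lincomb c V)))
                    (trans (ℚ.+-identityˡ _) (ℚ.*-identityʳ w)) ⟩
    lincomb c V ∷ʳ w
      ∎
    where open ≡-Reasoning

  sumℚ-∷ʳ : ∀ {k} (c : Vec ℚ k) w → sumℚ (c ∷ʳ w) ≡ sumℚ c + w
  sumℚ-∷ʳ [] w = trans (ℚ.+-identityʳ w) (sym (ℚ.+-identityˡ w))
  sumℚ-∷ʳ (a ∷ c) w = trans (cong (_+_ a) (sumℚ-∷ʳ c w)) (sym (ℚ.+-assoc a (sumℚ c) w))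

  sumℚ-scale : ∀ {k} s (c : Vec ℚ k) → sumℚ (map (s *_) c) ≡ s * sumℚ c
  sumℚ-scale s [] = sym (ℚ.*-zeroʳ s)
  sumℚ-scale s (a ∷ c) = trans (cong (_+_ (s * a)) (sumℚ-scale s c)) (sym (ℚ.*-distribˡ-+ s a (sumℚ c)))

  private
    All-∷ʳ⁻ : ∀ {k} {P : ℚ → Set} (c : Vec ℚ k) w → All P (c ∷ʳ w) → All P c × P w
    All-∷ʳ⁻ [] w (pw ∷ []) = [] , pw
    All-∷ʳ⁻ (a ∷ c) w (pa ∷ pcw) = let (pc , pw) = All-∷ʳ⁻ c w pcw in pa ∷ pc , pw

    All-∷ʳ⁺ : ∀ {k} {P : ℚ → Set} {c : Vec ℚ k} {w} → All P c → P w → All P (c ∷ʳ w)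
    All-∷ʳ⁺ [] pw = pw ∷ []
    All-∷ʳ⁺ (pa ∷ pc) pw = pa ∷ All-∷ʳ⁺ pc pw

  ScaledConv : ∀ {k N} → Vec (Vec ℤ N) k → ℚ → Pred (Vec ℚ N) 0ℓ
  ScaledConv V σ x = ∃ λ c → All (0ℚ ≤_) c × sumℚ c ≡ σ × x ≡ lincomb c V

  scaledConv-pyr : ∀ {k N} (V : Vec (Vec ℤ N) k) σ y w → ScaledConv (pyr V) σ (y ∷ʳ w) ⇔ (0ℚ ≤ w × ScaledConv V (σ - w) y)
  scaledConv-pyr V σ y w = mk⇔ to from
    where
    σ-w+w≡σ : ∀ σ w → σ - w + w ≡ σ
    σ-w+w≡σ = solve 2 (λ σ w → σ :- w :+ w := σ) refl
      where open +-*-Solver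
    a+w≡σ⇒a≡σ-w : ∀ {a} → a + w ≡ σ → a ≡ σ - w
    a+w≡σ⇒a≡σ-w {a} a+w≡σ = trans (sym (a+w-w a w)) (cong (_- w) a+w≡σ)
      where
      open +-*-Solver
      a+w-w : ∀ a w → a + w - w ≡ a
      a+w-w = solve 2 (λ a w → a :+ w :- w := a) refl
    to : ScaledConv (pyr V) σ (y ∷ʳ w) → 0ℚ ≤ w × ScaledConv V (σ - w) y
    to (c , 0≤c , Σc≡σ , eq) with initLast c
    ... | c' , w' , refl with ∷ʳ-injective y (lincomb c' V) (trans eq (lincomb-pyr c' V w'))
    ... | refl , refl = let (0≤c' , 0≤w) = All-∷ʳ⁻ c' w 0≤c in
      0≤w , c' , 0≤c' , a+w≡σ⇒a≡σ-w (trans (sym (sumℚ-∷ʳ c' w)) Σc≡σ) , refl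
    from : 0ℚ ≤ w × ScaledConv V (σ - w) y → ScaledConv (pyr V) σ (y ∷ʳ w)
    from (0≤w , c , 0≤c , Σc≡σ-w , refl) =
      c ∷ʳ w , All-∷ʳ⁺ 0≤c 0≤w ,
      trans (sumℚ-∷ʳ c w) (trans (cong (_+ w) Σc≡σ-w) (σ-w+w≡σ σ w)) ,
      sym (lincomb-pyr c V w)

module ReeveHull where

  open import Data.Nat using (ℕ; suc)
  open import Data.Integer as ℤ using (ℤ; +_)
  open import Data.Rational using (ℚ; 0ℚ; 1ℚ; _+_; _*_; _-_; _≤_)
  import Data.Rational.Properties as ℚ
  open import Data.Rational.Solver using (module +-*-Solver)
  open import Data.Vec using ([]; _∷_; map)
  open import Data.Vec.Properties using (∷-injective)
  open import Data.Vec.Relation.Unary.All using ([]; _∷_)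
  open import Data.Product using (_×_; _,_; proj₁; proj₂)
  open import Function using (_⇔_; mk⇔)
  open import Relation.Unary using (_∈_)
  open import Relation.Binary.PropositionalEquality using (_≡_; refl; sym; trans; cong; cong₂; subst; module ≡-Reasoning)
  open import Defs using (ℤ→ℚ; reeveVerts; lincomb)
  open RationalEmbedding
  open ConvexHulls
  open ReeveLattice

  module _ (mm : ℕ) where

    open Reciprocal mm renaming (τ to μ; τ⁻¹ to μ⁻¹; τ⁻¹*τ≡1 to μ⁻¹*μ≡1; 0≤τ to 0≤μ; 0≤τ⁻¹ to 0≤μ⁻¹)
    open +-*-Solver

    private
      M : ℤ
      M = + suc mm

      ι-Mx-z : ∀ x z → ℤ→ℚ (M ℤ.* x ℤ.- z) ≡ μ * ℤ→ℚ x - ℤ→ℚ z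
      ι-Mx-z x z = trans (ℤ→ℚ-minus (M ℤ.* x) z) (cong (_- ℤ→ℚ z) (ℤ→ℚ-* M x))

      ι-M[s-x-y]+z : ∀ s x y z →
        ℤ→ℚ (M ℤ.* (s ℤ.- x ℤ.- y) ℤ.+ z) ≡ μ * (ℤ→ℚ s - ℤ→ℚ x - ℤ→ℚ y) + ℤ→ℚ z
      ι-M[s-x-y]+z s x y z
        rewrite ℤ→ℚ-+ (M ℤ.* (s ℤ.- x ℤ.- y)) z | ℤ→ℚ-* M (s ℤ.- x ℤ.- y)
              | ℤ→ℚ-minus (s ℤ.- x) y | ℤ→ℚ-minus s x = refl

      nonneg-from-ℚ : ∀ e c → ℤ→ℚ e ≡ μ * c → 0ℚ ≤ c → ℤ.0ℤ ℤ.≤ e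
      nonneg-from-ℚ e c ιe≡μc 0≤c = ℤ→ℚ-cancel-≤ (subst (0ℚ ≤_) (sym ιe≡μc) (0≤-*ℚ 0≤μ 0≤c))

      ∷₃-injective : ∀ {a b c a' b' c' : ℚ} → a ∷ b ∷ c ∷ [] ≡ a' ∷ b' ∷ c' ∷ [] → a ≡ a' × b ≡ b' × c ≡ c'
      ∷₃-injective eq =
        let (a≡ , eq') = ∷-injective eq ; (b≡ , eq'') = ∷-injective eq' in a≡ , b≡ , proj₁ (∷-injective eq'')

      cancel-μ : ∀ q → μ⁻¹ * μ * q ≡ q
      cancel-μ q = trans (cong (_* q) μ⁻¹*μ≡1) (ℚ.*-identityˡ q)

    lincomb-reeve : ∀ c₀ c₁ c₂ c₃ →
      lincomb (c₀ ∷ c₁ ∷ c₂ ∷ c₃ ∷ []) (reeveVerts (suc mm)) ≡ c₁ + c₃ ∷ c₂ + c₃ ∷ μ * c₃ ∷ []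
    lincomb-reeve c₀ c₁ c₂ c₃ =
      cong₂ _∷_ (first c₀ c₁ c₂ c₃) (cong₂ _∷_ (second c₀ c₁ c₂ c₃) (cong (_∷ []) (third c₀ c₁ c₂ c₃ μ)))
      where
      first : ∀ a b c d → a * 0ℚ + (b * 1ℚ + (c * 0ℚ + (d * 1ℚ + 0ℚ))) ≡ b + d
      first = solve 4 (λ a b c d → a :* con 0ℚ :+ (b :* con 1ℚ :+ (c :* con 0ℚ :+ (d :* con 1ℚ :+ con 0ℚ))) := b :+ d) refl
      second : ∀ a b c d → a * 0ℚ + (b * 0ℚ + (c * 1ℚ + (d * 1ℚ + 0ℚ))) ≡ c + d
      second = solve 4 (λ a b c d → a :* con 0ℚ :+ (b :* con 0ℚ :+ (c :* con 1ℚ :+ (d :* con 1ℚ :+ con 0ℚ))) := c :+ d) refl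
      third : ∀ a b c d μ → a * 0ℚ + (b * 0ℚ + (c * 0ℚ + (d * μ + 0ℚ))) ≡ μ * d
      third = solve 5 (λ a b c d μ → a :* con 0ℚ :+ (b :* con 0ℚ :+ (c :* con 0ℚ :+ (d :* μ :+ con 0ℚ))) := μ :* d) refl

    reeve-coordinates : ∀ {s x y z} → ScaledConv (reeveVerts (suc mm)) (ℤ→ℚ s) (map ℤ→ℚ (x ∷ y ∷ z ∷ [])) →
      (x ∷ y ∷ z ∷ []) ∈ ReeveLattice (suc mm) s
    reeve-coordinates {s} {x} {y} {z}
      (c₀ ∷ c₁ ∷ c₂ ∷ c₃ ∷ [] , 0≤c₀ ∷ 0≤c₁ ∷ 0≤c₂ ∷ 0≤c₃ ∷ [] , Σc≡s , eq) =
      nonneg-from-ℚ z c₃ ιz≡ 0≤c₃ ,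
      nonneg-from-ℚ (M ℤ.* x ℤ.- z) c₁ (side x c₁ ιx≡) 0≤c₁ ,
      nonneg-from-ℚ (M ℤ.* y ℤ.- z) c₂ (side y c₂ ιy≡) 0≤c₂ ,
      nonneg-from-ℚ (M ℤ.* (s ℤ.- x ℤ.- y) ℤ.+ z) c₀ base 0≤c₀
      where
      open ≡-Reasoning
      coordinates : ℤ→ℚ x ≡ c₁ + c₃ × ℤ→ℚ y ≡ c₂ + c₃ × ℤ→ℚ z ≡ μ * c₃
      coordinates = ∷₃-injective (trans eq (lincomb-reeve c₀ c₁ c₂ c₃))
      ιx≡ : ℤ→ℚ x ≡ c₁ + c₃
      ιx≡ = proj₁ coordinates
      ιy≡ : ℤ→ℚ y ≡ c₂ + c₃
      ιy≡ = proj₁ (proj₂ coordinates)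
      ιz≡ : ℤ→ℚ z ≡ μ * c₃
      ιz≡ = proj₂ (proj₂ coordinates)
      side : ∀ x c → ℤ→ℚ x ≡ c + c₃ → ℤ→ℚ (M ℤ.* x ℤ.- z) ≡ μ * c
      side x c ιx≡c+c₃ = begin
        ℤ→ℚ (M ℤ.* x ℤ.- z)      ≡⟨ ι-Mx-z x z ⟩
        μ * ℤ→ℚ x - ℤ→ℚ z       ≡⟨ cong₂ (λ X Z → μ * X - Z) ιx≡c+c₃ ιz≡ ⟩
        μ * (c + c₃) - μ * c₃    ≡⟨ solve 3 (λ μ c c₃ → μ :* (c :+ c₃) :- μ :* c₃ := μ :* c) refl μ c c₃ ⟩
        μ * c                    ∎
      base : ℤ→ℚ (M ℤ.* (s ℤ.- x ℤ.- y) ℤ.+ z) ≡ μ * c₀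
      base = begin
        ℤ→ℚ (M ℤ.* (s ℤ.- x ℤ.- y) ℤ.+ z)
          ≡⟨ ι-M[s-x-y]+z s x y z ⟩
        μ * (ℤ→ℚ s - ℤ→ℚ x - ℤ→ℚ y) + ℤ→ℚ z
          ≡⟨ cong₂ (λ S X → μ * (S - X - ℤ→ℚ y) + ℤ→ℚ z) (sym Σc≡s) ιx≡ ⟩
        μ * (c₀ + (c₁ + (c₂ + (c₃ + 0ℚ))) - (c₁ + c₃) - ℤ→ℚ y) + ℤ→ℚ z
          ≡⟨ cong₂ (λ Y Z → μ * (c₀ + (c₁ + (c₂ + (c₃ + 0ℚ))) - (c₁ + c₃) - Y) + Z) ιy≡ ιz≡ ⟩
        μ * (c₀ + (c₁ + (c₂ + (c₃ + 0ℚ))) - (c₁ + c₃) - (c₂ + c₃)) + μ * c₃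
          ≡⟨ solve 5 (λ μ a b c d → μ :* (a :+ (b :+ (c :+ (d :+ con 0ℚ))) :- (b :+ d) :- (c :+ d)) :+ μ :* d := μ :* a)
                     refl μ c₀ c₁ c₂ c₃ ⟩
        μ * c₀
          ∎

    reeve-barycentric : ∀ {s x y z} → (x ∷ y ∷ z ∷ []) ∈ ReeveLattice (suc mm) s →
      ScaledConv (reeveVerts (suc mm)) (ℤ→ℚ s) (map ℤ→ℚ (x ∷ y ∷ z ∷ []))
    reeve-barycentric {s} {x} {y} {z} (0≤z , 0≤Mx-z , 0≤My-z , 0≤base) =
      c₀ ∷ c₁ ∷ c₂ ∷ c₃ ∷ [] ,
      weight 0≤base ∷ weight 0≤Mx-z ∷ weight 0≤My-z ∷ weight 0≤z ∷ [] ,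
      total ,
      sym (trans (lincomb-reeve c₀ c₁ c₂ c₃) (cong₂ _∷_ (side x) (cong₂ _∷_ (side y) (cong (_∷ []) top))))
      where
      open ≡-Reasoning
      X Y Z S : ℚ
      X = ℤ→ℚ x
      Y = ℤ→ℚ y
      Z = ℤ→ℚ z
      S = ℤ→ℚ s
      c₀ c₁ c₂ c₃ : ℚ
      c₀ = μ⁻¹ * ℤ→ℚ (M ℤ.* (s ℤ.- x ℤ.- y) ℤ.+ z)
      c₁ = μ⁻¹ * ℤ→ℚ (M ℤ.* x ℤ.- z)
      c₂ = μ⁻¹ * ℤ→ℚ (M ℤ.* y ℤ.- z)
      c₃ = μ⁻¹ * Z
      weight : ∀ {e} → ℤ.0ℤ ℤ.≤ e → 0ℚ ≤ μ⁻¹ * ℤ→ℚ e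
      weight 0≤e = 0≤-*ℚ 0≤μ⁻¹ (ℤ→ℚ-mono-≤ 0≤e)
      side : ∀ x → μ⁻¹ * ℤ→ℚ (M ℤ.* x ℤ.- z) + c₃ ≡ ℤ→ℚ x
      side x = begin
        μ⁻¹ * ℤ→ℚ (M ℤ.* x ℤ.- z) + μ⁻¹ * Z
          ≡⟨ cong (λ e → μ⁻¹ * e + μ⁻¹ * Z) (ι-Mx-z x z) ⟩
        μ⁻¹ * (μ * ℤ→ℚ x - Z) + μ⁻¹ * Z
          ≡⟨ solve 4 (λ ν μ X Z → ν :* (μ :* X :- Z) :+ ν :* Z := ν :* μ :* X) refl μ⁻¹ μ (ℤ→ℚ x) Z ⟩
        μ⁻¹ * μ * ℤ→ℚ x
          ≡⟨ cancel-μ (ℤ→ℚ x) ⟩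
        ℤ→ℚ x
          ∎
      top : μ * c₃ ≡ Z
      top = trans (solve 3 (λ μ ν Z → μ :* (ν :* Z) := ν :* μ :* Z) refl μ μ⁻¹ Z) (cancel-μ Z)
      total : c₀ + (c₁ + (c₂ + (c₃ + 0ℚ))) ≡ S
      total = begin
        c₀ + (c₁ + (c₂ + (c₃ + 0ℚ)))
          ≡⟨ cong₂ (λ e₀ e₁ → μ⁻¹ * e₀ + (μ⁻¹ * e₁ + (c₂ + (c₃ + 0ℚ))))
                   (ι-M[s-x-y]+z s x y z) (ι-Mx-z x z) ⟩
        μ⁻¹ * (μ * (S - X - Y) + Z) + (μ⁻¹ * (μ * X - Z) + (c₂ + (c₃ + 0ℚ)))
          ≡⟨ cong (λ e₂ → μ⁻¹ * (μ * (S - X - Y) + Z) + (μ⁻¹ * (μ * X - Z) + (μ⁻¹ * e₂ + (c₃ + 0ℚ))))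
                  (ι-Mx-z y z) ⟩
        μ⁻¹ * (μ * (S - X - Y) + Z) + (μ⁻¹ * (μ * X - Z) + (μ⁻¹ * (μ * Y - Z) + (μ⁻¹ * Z + 0ℚ)))
          ≡⟨ solve 6 (λ ν μ S X Y Z → ν :* (μ :* (S :- X :- Y) :+ Z) :+ (ν :* (μ :* X :- Z) :+ (ν :* (μ :* Y :- Z)
                                        :+ (ν :* Z :+ con 0ℚ))) := ν :* μ :* S)
                     refl μ⁻¹ μ S X Y Z ⟩
        μ⁻¹ * μ * S
          ≡⟨ cancel-μ S ⟩
        S ∎

    scaledConv-reeve : ∀ s v → ScaledConv (reeveVerts (suc mm)) (ℤ→ℚ s) (map ℤ→ℚ v) ⇔ v ∈ ReeveLattice (suc mm) s
    scaledConv-reeve s (x ∷ y ∷ z ∷ []) = mk⇔ (reeve-coordinates {s} {x} {y} {z}) (reeve-barycentric {s} {x} {y} {z})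

module Dilation where

  open import Data.Nat using (ℕ; zero; suc; _^_)
  import Data.Nat as ℕ
  open import Data.Integer as ℤ using (ℤ; +_)
  import Data.Integer.Properties as ℤ
  open import Data.Rational using (ℚ; 0ℚ; 1ℚ; _*_; _-_; _≤_; NonNegative; nonNegative)
  import Data.Rational.Properties as ℚ
  open import Data.Vec using (Vec; []; _∷_; _∷ʳ_; _++_; map; lookup; initLast; splitAt)
  open import Data.Vec.Properties using (lookup-map; map-++; map-∷ʳ; ++-injective; ∷ʳ-injective)
  open import Data.Vec.Relation.Unary.All as All using (All)
  open import Data.Vec.Relation.Unary.All.Properties using (map⁺; lookup⁺; lookup⁻)
  open import Data.Product as Product using (_×_; _,_; proj₁; proj₂; uncurry)
  open import Function using (_⇔_; mk⇔; Equivalence)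
  open import Relation.Unary using (_∈_; _≐_; _⟨×⟩_)
  open import Relation.Binary.PropositionalEquality using (_≡_; refl; sym; trans; cong; cong₂; subst; subst₂)
  open import Defs
  open Enumerations
  open RationalEmbedding
  open ConvexHulls
  open ReeveHull
  open LatticeCounts
  open CubeLattice

  dilate-⊠ : ∀ t {N M} {P : Region N} {Q : Region M} y z → dilate t (P ⊠ Q) (y ++ z) ⇔ (dilate t P y × dilate t Q z)
  dilate-⊠ t {P = P} {Q} y z = mk⇔ to from
    where
    f : ℚ → ℚ
    f q = ℤ→ℚ (+ t) * q
    to : dilate t (P ⊠ Q) (y ++ z) → dilate t P y × dilate t Q z
    to (_ , (w₁ , w₂ , refl , w₁∈P , w₂∈Q) , y++z≡) =
      let (y≡ , z≡) = ++-injective y (map f w₁) (trans y++z≡ (map-++ f w₁ w₂)) in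
      (w₁ , w₁∈P , y≡) , (w₂ , w₂∈Q , z≡)
    from : dilate t P y × dilate t Q z → dilate t (P ⊠ Q) (y ++ z)
    from ((w₁ , w₁∈P , refl) , (w₂ , w₂∈Q , refl)) =
      w₁ ++ w₂ , (w₁ , w₂ , refl , w₁∈P , w₂∈Q) , sym (map-++ f w₁ w₂)

  scaledConv-pyrReeve : ∀ mm r s v →
    ScaledConv (pyrⁿ r (reeveVerts (suc mm))) (ℤ→ℚ s) (map ℤ→ℚ v) ⇔ v ∈ PyrReeveLattice (suc mm) r s
  scaledConv-pyrReeve mm zero s v = scaledConv-reeve mm s v
  scaledConv-pyrReeve mm (suc r) s v with initLast v
  ... | y , w , refl = mk⇔ to from
    where
    V : Vec (Vec ℤ (r ℕ.+ 3)) (r ℕ.+ 4)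
    V = pyrⁿ r (reeveVerts (suc mm))
    ι-level : ℤ→ℚ s - ℤ→ℚ w ≡ ℤ→ℚ (s ℤ.- w)
    ι-level = sym (ℤ→ℚ-minus s w)
    to : ScaledConv (pyr V) (ℤ→ℚ s) (map ℤ→ℚ (y ∷ʳ w)) → (y ∷ʳ w) ∈ PyrReeveLattice (suc mm) (suc r) s
    to y∷ʳw∈ with Equivalence.to (scaledConv-pyr V (ℤ→ℚ s) (map ℤ→ℚ y) (ℤ→ℚ w))
                   (subst (ScaledConv (pyr V) (ℤ→ℚ s)) (map-∷ʳ ℤ→ℚ w y) y∷ʳw∈)
    ... | 0≤ιw , y∈ = (y , w) , (ℤ→ℚ-cancel-≤ 0≤ιw , Equivalence.to (scaledConv-pyrReeve mm r (s ℤ.- w) y)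
                                                      (subst (λ σ → ScaledConv V σ (map ℤ→ℚ y)) ι-level y∈)) , refl
    from : (y ∷ʳ w) ∈ PyrReeveLattice (suc mm) (suc r) s → ScaledConv (pyr V) (ℤ→ℚ s) (map ℤ→ℚ (y ∷ʳ w))
    from ((y' , w') , (0≤w' , y'∈) , eq) with ∷ʳ-injective y' y eq
    ... | refl , refl = subst (ScaledConv (pyr V) (ℤ→ℚ s)) (sym (map-∷ʳ ℤ→ℚ w y))
      (Equivalence.from (scaledConv-pyr V (ℤ→ℚ s) (map ℤ→ℚ y) (ℤ→ℚ w))
        (ℤ→ℚ-mono-≤ 0≤w' , subst (λ σ → ScaledConv V σ (map ℤ→ℚ y)) (sym ι-level)
                             (Equivalence.from (scaledConv-pyrReeve mm r (s ℤ.- w) y) y'∈)))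

  module _ (k : ℕ) where

    open Reciprocal k

    private
      rescale : ∀ {N} a b → b * a ≡ 1ℚ → (x : Vec ℚ N) → map (b *_) (map (a *_) x) ≡ x
      rescale a b ba≡1 [] = refl
      rescale a b ba≡1 (q ∷ x) =
        cong₂ _∷_ (trans (sym (ℚ.*-assoc b a q)) (trans (cong (_* q) ba≡1) (ℚ.*-identityˡ q))) (rescale a b ba≡1 x)

      scale-nonneg : ∀ {k} {s} (c : Vec ℚ k) → 0ℚ ≤ s → All (0ℚ ≤_) c → All (0ℚ ≤_) (map (s *_) c)
      scale-nonneg c 0≤s 0≤c = map⁺ (All.map (0≤-*ℚ 0≤s) 0≤c)

    dilate-conv : ∀ {n N} (V : Vec (Vec ℤ N) n) x → dilate (suc k) (conv V) x ⇔ ScaledConv V τ x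
    dilate-conv V x = mk⇔ to from
      where
      to : dilate (suc k) (conv V) x → ScaledConv V τ x
      to (y , (c , 0≤c , Σc≡1 , refl) , refl) =
        map (τ *_) c , scale-nonneg c 0≤τ (lookup⁻ 0≤c) ,
        trans (sumℚ-scale τ c) (trans (cong (τ *_) Σc≡1) (ℚ.*-identityʳ τ)) ,
        sym (lincomb-scale τ c V)
      from : ScaledConv V τ x → dilate (suc k) (conv V) x
      from (c , 0≤c , Σc≡τ , refl) =
        map (τ⁻¹ *_) (lincomb c V) ,
        (map (τ⁻¹ *_) c , lookup⁺ (scale-nonneg c 0≤τ⁻¹ 0≤c) ,
         trans (sumℚ-scale τ⁻¹ c) (trans (cong (τ⁻¹ *_) Σc≡τ) τ⁻¹*τ≡1) , sym (lincomb-scale τ⁻¹ c V)) ,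
        sym (rescale τ⁻¹ τ τ*τ⁻¹≡1 (lincomb c V))

    dilate-cube : ∀ a n z → dilate (suc k) (cube a n) (map ℤ→ℚ z) ⇔ z ∈ CubeLattice (suc k ℕ.* a) n
    dilate-cube a n z = mk⇔ to from
      where
      instance
        τ-nonneg : NonNegative τ
        τ-nonneg = nonNegative 0≤τ
        τ⁻¹-nonneg : NonNegative τ⁻¹
        τ⁻¹-nonneg = nonNegative 0≤τ⁻¹
      ι[ta]≡τ*ιa : ℤ→ℚ (+ (suc k ℕ.* a)) ≡ τ * ℤ→ℚ (+ a)
      ι[ta]≡τ*ιa = trans (cong ℤ→ℚ (ℤ.pos-* (suc k) a)) (ℤ→ℚ-* (+ suc k) (+ a))
      to : dilate (suc k) (cube a n) (map ℤ→ℚ z) → z ∈ CubeLattice (suc k ℕ.* a) n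
      to (y , y∈cube , ιz≡τy) i =
        ℤ→ℚ-cancel-≤ (subst (0ℚ ≤_) (sym ιzᵢ≡τyᵢ) (0≤-*ℚ 0≤τ (proj₁ (y∈cube i)))) ,
        ℤ→ℚ-cancel-≤ (subst₂ _≤_ (sym ιzᵢ≡τyᵢ) (sym ι[ta]≡τ*ιa) (ℚ.*-monoˡ-≤-nonNeg τ (proj₂ (y∈cube i))))
        where
        ιzᵢ≡τyᵢ : ℤ→ℚ (lookup z i) ≡ τ * lookup y i
        ιzᵢ≡τyᵢ = trans (sym (lookup-map i ℤ→ℚ z)) (trans (cong (λ v → lookup v i) ιz≡τy) (lookup-map i (τ *_) y))
      from : z ∈ CubeLattice (suc k ℕ.* a) n → dilate (suc k) (cube a n) (map ℤ→ℚ z)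
      from z∈C = map (τ⁻¹ *_) (map ℤ→ℚ z) , y∈cube , sym (rescale τ⁻¹ τ τ*τ⁻¹≡1 (map ℤ→ℚ z))
        where
        yᵢ≡ : ∀ i → lookup (map (τ⁻¹ *_) (map ℤ→ℚ z)) i ≡ τ⁻¹ * ℤ→ℚ (lookup z i)
        yᵢ≡ i = trans (lookup-map i (τ⁻¹ *_) (map ℤ→ℚ z)) (cong (τ⁻¹ *_) (lookup-map i ℤ→ℚ z))
        y∈cube : cube a n (map (τ⁻¹ *_) (map ℤ→ℚ z))
        y∈cube i = subst (0ℚ ≤_) (sym (yᵢ≡ i)) (0≤-*ℚ 0≤τ⁻¹ (ℤ→ℚ-mono-≤ (proj₁ (z∈C i)))) ,
                   subst (_≤ ℤ→ℚ (+ a)) (sym (yᵢ≡ i)) (begin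
                     τ⁻¹ * ℤ→ℚ (lookup z i)          ≤⟨ ℚ.*-monoˡ-≤-nonNeg τ⁻¹ (ℤ→ℚ-mono-≤ (proj₂ (z∈C i))) ⟩
                     τ⁻¹ * ℤ→ℚ (+ (suc k ℕ.* a))     ≡⟨ cong (τ⁻¹ *_) ι[ta]≡τ*ιa ⟩
                     τ⁻¹ * (τ * ℤ→ℚ (+ a))           ≡⟨ τ⁻¹*[τ*q]≡q (ℤ→ℚ (+ a)) ⟩
                     ℤ→ℚ (+ a)                       ∎)
          where open ℚ.≤-Reasoning

    thePolytope-lattice : ∀ mm n r →
      (λ x → dilate (suc k) (thePolytope (suc mm) n r) (map ℤ→ℚ x)) ≐
      Image (uncurry _++_) (PyrReeveLattice (suc mm) r (+ suc k) ⟨×⟩ CubeLattice (suc k ℕ.* n) n)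
    thePolytope-lattice mm n r = to , from
      where
      V : Vec (Vec ℤ (r ℕ.+ 3)) (r ℕ.+ 4)
      V = pyrⁿ r (reeveVerts (suc mm))
      to : ∀ {x} → dilate (suc k) (thePolytope (suc mm) n r) (map ℤ→ℚ x) →
        x ∈ Image (uncurry _++_) (PyrReeveLattice (suc mm) r (+ suc k) ⟨×⟩ CubeLattice (suc k ℕ.* n) n)
      to {x} x∈ with splitAt (r ℕ.+ 3) x
      ... | y , z , refl with Equivalence.to (dilate-⊠ (suc k) (map ℤ→ℚ y) (map ℤ→ℚ z))
                                (subst (dilate (suc k) (thePolytope (suc mm) n r)) (map-++ ℤ→ℚ y z) x∈)
      ... | y∈ , z∈ = (y , z) , (Equivalence.to (scaledConv-pyrReeve mm r (+ suc k) y)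
                                   (Equivalence.to (dilate-conv V (map ℤ→ℚ y)) y∈) ,
                                 Equivalence.to (dilate-cube n n z) z∈) , refl
      from : ∀ {x} → x ∈ Image (uncurry _++_) (PyrReeveLattice (suc mm) r (+ suc k) ⟨×⟩ CubeLattice (suc k ℕ.* n) n) →
        dilate (suc k) (thePolytope (suc mm) n r) (map ℤ→ℚ x)
      from ((y , z) , (y∈ , z∈) , refl) = subst (dilate (suc k) (thePolytope (suc mm) n r)) (sym (map-++ ℤ→ℚ y z))
        (Equivalence.from (dilate-⊠ (suc k) (map ℤ→ℚ y) (map ℤ→ℚ z))
          (Equivalence.from (dilate-conv V (map ℤ→ℚ y)) (Equivalence.from (scaledConv-pyrReeve mm r (+ suc k) y) y∈) ,
           Equivalence.from (dilate-cube n n z) z∈))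

    thePolytope-latticeCount : ∀ mm n r →
      LatticeCount (dilate (suc k) (thePolytope (suc mm) n r)) (pyrReeveCount mm r (suc k) ℕ.* suc (suc k ℕ.* n) ^ n)
    thePolytope-latticeCount mm n r = enum-≐ (Product.swap (thePolytope-lattice mm n r))
      (enum-image (uncurry _++_) (λ _ _ eq → uncurry (cong₂ _,_) (++-injective _ _ eq))
        (enum-⟨×⟩ (enum-pyrReeve mm r (suc k)) (enum-cube (suc k ℕ.* n) n)))

module IntegerPolynomials where

  open import Data.Nat using (ℕ; zero; suc)
  open import Data.Integer using (ℤ; +_; 0ℤ; _+_; _-_; _*_; _^_)
  import Data.Integer.Properties as ℤ
  open import Data.Integer.Tactic.RingSolver using (solve-∀)
  open import Data.Vec using (Vec; []; _∷_; _∷ʳ_; map; zipWith)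
  open import Relation.Binary.PropositionalEquality using (_≡_; refl; sym; trans; cong; cong₂; module ≡-Reasoning)

  evalℤ : ∀ {n} → Vec ℤ n → ℤ → ℤ
  evalℤ [] x = 0ℤ
  evalℤ (a ∷ p) x = a + x * evalℤ p x

  coeff : ∀ {n} → Vec ℤ n → ℕ → ℤ
  coeff [] j = 0ℤ
  coeff (a ∷ p) zero = a
  coeff (a ∷ p) (suc j) = coeff p j

  infixl 6 _+ᵖ_
  _+ᵖ_ : ∀ {n} → Vec ℤ n → Vec ℤ n → Vec ℤ n
  _+ᵖ_ = zipWith _+_

  infixr 7 _·ᵖ_
  _·ᵖ_ : ∀ {n} → ℤ → Vec ℤ n → Vec ℤ n
  a ·ᵖ p = map (a *_) p

  shift : ∀ {n} → Vec ℤ n → Vec ℤ (suc n)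
  shift p = 0ℤ ∷ p

  pad : ∀ {n} → Vec ℤ n → Vec ℤ (suc n)
  pad p = p ∷ʳ 0ℤ

  Δ : ∀ {n} → Vec ℤ n → ℕ → ℤ
  Δ p j = coeff p j - coeff (shift p) j

  plusX : ∀ {n} → Vec ℤ n → Vec ℤ n → Vec ℤ (suc n)
  plusX p q = pad p +ᵖ shift q

  mulLinear : ∀ {n} → ℤ → ℤ → Vec ℤ n → Vec ℤ (suc n)
  mulLinear a b p = plusX (a ·ᵖ p) (b ·ᵖ p)

  mulQuadratic : ∀ {n} → ℤ → ℤ → ℤ → Vec ℤ n → Vec ℤ (suc (suc n))
  mulQuadratic a b c p = plusX (pad (a ·ᵖ p)) (mulLinear b c p)

  evalℤ-+ᵖ : ∀ {n} (p q : Vec ℤ n) x → evalℤ (p +ᵖ q) x ≡ evalℤ p x + evalℤ q x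
  evalℤ-+ᵖ [] [] x = refl
  evalℤ-+ᵖ (a ∷ p) (b ∷ q) x rewrite evalℤ-+ᵖ p q x = regroup a b x (evalℤ p x) (evalℤ q x)
    where
    regroup : ∀ a b x e f → a + b + x * (e + f) ≡ a + x * e + (b + x * f)
    regroup = solve-∀

  evalℤ-·ᵖ : ∀ {n} a (p : Vec ℤ n) x → evalℤ (a ·ᵖ p) x ≡ a * evalℤ p x
  evalℤ-·ᵖ a [] x = sym (ℤ.*-zeroʳ a)
  evalℤ-·ᵖ a (b ∷ p) x rewrite evalℤ-·ᵖ a p x = regroup a b x (evalℤ p x)
    where
    regroup : ∀ a b x e → a * b + x * (a * e) ≡ a * (b + x * e)
    regroup = solve-∀

  evalℤ-pad : ∀ {n} (p : Vec ℤ n) x → evalℤ (pad p) x ≡ evalℤ p x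
  evalℤ-pad [] x = trans (ℤ.+-identityˡ (x * 0ℤ)) (ℤ.*-zeroʳ x)
  evalℤ-pad (a ∷ p) x = cong (λ e → a + x * e) (evalℤ-pad p x)

  evalℤ-plusX : ∀ {n} (p q : Vec ℤ n) x → evalℤ (plusX p q) x ≡ evalℤ p x + x * evalℤ q x
  evalℤ-plusX p q x = trans (evalℤ-+ᵖ (pad p) (shift q) x) (cong₂ _+_ (evalℤ-pad p x) (ℤ.+-identityˡ (x * evalℤ q x)))

  evalℤ-mulLinear : ∀ {n} a b (p : Vec ℤ n) x → evalℤ (mulLinear a b p) x ≡ (a + b * x) * evalℤ p x
  evalℤ-mulLinear a b p x
    rewrite evalℤ-plusX (a ·ᵖ p) (b ·ᵖ p) x | evalℤ-·ᵖ a p x | evalℤ-·ᵖ b p x = collect a b x (evalℤ p x)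
    where
    collect : ∀ a b x e → a * e + x * (b * e) ≡ (a + b * x) * e
    collect = solve-∀

  evalℤ-mulQuadratic : ∀ {n} a b c (p : Vec ℤ n) x → evalℤ (mulQuadratic a b c p) x ≡ (a + b * x + c * x * x) * evalℤ p x
  evalℤ-mulQuadratic a b c p x
    rewrite evalℤ-plusX (pad (a ·ᵖ p)) (mulLinear b c p) x | evalℤ-pad (a ·ᵖ p) x
          | evalℤ-·ᵖ a p x | evalℤ-mulLinear b c p x =
    collect a b c x (evalℤ p x)
    where
    collect : ∀ a b c x e → a * e + x * ((b + c * x) * e) ≡ (a + b * x + c * x * x) * e
    collect = solve-∀

  coeff-+ᵖ : ∀ {n} (p q : Vec ℤ n) j → coeff (p +ᵖ q) j ≡ coeff p j + coeff q j
  coeff-+ᵖ [] [] j = refl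
  coeff-+ᵖ (a ∷ p) (b ∷ q) zero = refl
  coeff-+ᵖ (a ∷ p) (b ∷ q) (suc j) = coeff-+ᵖ p q j

  coeff-·ᵖ : ∀ {n} a (p : Vec ℤ n) j → coeff (a ·ᵖ p) j ≡ a * coeff p j
  coeff-·ᵖ a [] j = sym (ℤ.*-zeroʳ a)
  coeff-·ᵖ a (b ∷ p) zero = refl
  coeff-·ᵖ a (b ∷ p) (suc j) = coeff-·ᵖ a p j

  coeff-pad : ∀ {n} (p : Vec ℤ n) j → coeff (pad p) j ≡ coeff p j
  coeff-pad [] zero = refl
  coeff-pad [] (suc j) = refl
  coeff-pad (a ∷ p) zero = refl
  coeff-pad (a ∷ p) (suc j) = coeff-pad p j

  coeff-plusX : ∀ {n} (p q : Vec ℤ n) j → coeff (plusX p q) j ≡ coeff p j + coeff (shift q) j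
  coeff-plusX p q j = trans (coeff-+ᵖ (pad p) (shift q) j) (cong (_+ coeff (shift q) j) (coeff-pad p j))

  coeff-mulLinear : ∀ {n} a b (p : Vec ℤ n) j → coeff (mulLinear a b p) j ≡ a * coeff p j + b * coeff (shift p) j
  coeff-mulLinear a b p zero = trans (coeff-plusX (a ·ᵖ p) (b ·ᵖ p) zero) (cong₂ _+_ (coeff-·ᵖ a p zero) (sym (ℤ.*-zeroʳ b)))
  coeff-mulLinear a b p (suc j) =
    trans (coeff-plusX (a ·ᵖ p) (b ·ᵖ p) (suc j)) (cong₂ _+_ (coeff-·ᵖ a p (suc j)) (coeff-·ᵖ b p j))

  coeff-mulQuadratic : ∀ {n} a b c (p : Vec ℤ n) j →
    coeff (mulQuadratic a b c p) (suc j) ≡ a * coeff p (suc j) + b * coeff p j + c * coeff (shift p) j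
  coeff-mulQuadratic a b c p j = begin
    coeff (mulQuadratic a b c p) (suc j)
      ≡⟨ coeff-plusX (pad (a ·ᵖ p)) (mulLinear b c p) (suc j) ⟩
    coeff (pad (a ·ᵖ p)) (suc j) + coeff (mulLinear b c p) j
      ≡⟨ cong₂ _+_ (trans (coeff-pad (a ·ᵖ p) (suc j)) (coeff-·ᵖ a p (suc j))) (coeff-mulLinear b c p j) ⟩
    a * coeff p (suc j) + (b * coeff p j + c * coeff (shift p) j)
      ≡⟨ ℤ.+-assoc (a * coeff p (suc j)) (b * coeff p j) (c * coeff (shift p) j) ⟨
    a * coeff p (suc j) + b * coeff p j + c * coeff (shift p) j
      ∎
    where open ≡-Reasoning

  Δ-mulLinear : ∀ {n} a b (p : Vec ℤ n) j → Δ (mulLinear a b p) j ≡ a * Δ p j + b * Δ (shift p) j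
  Δ-mulLinear a b p j = begin
    coeff (mulLinear a b p) j - coeff (shift (mulLinear a b p)) j
      ≡⟨ cong₂ _-_ (coeff-mulLinear a b p j) (shifted j) ⟩
    (a * coeff p j + b * coeff (shift p) j) - (a * coeff (shift p) j + b * coeff (shift (shift p)) j)
      ≡⟨ regroup a b (coeff p j) (coeff (shift p) j) (coeff (shift (shift p)) j) ⟩
    a * Δ p j + b * Δ (shift p) j
      ∎
    where
    open ≡-Reasoning
    shifted : ∀ j → coeff (shift (mulLinear a b p)) j ≡ a * coeff (shift p) j + b * coeff (shift (shift p)) j
    shifted zero = solve-zero a b
      where
      solve-zero : ∀ a b → 0ℤ ≡ a * 0ℤ + b * 0ℤ
      solve-zero = solve-∀
    shifted (suc j) = coeff-mulLinear a b p j
    regroup : ∀ a b x y z → a * x + b * y - (a * y + b * z) ≡ a * (x - y) + b * (y - z)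
    regroup = solve-∀

  linearPower : ℕ → (k : ℕ) → Vec ℤ (suc k)
  linearPower N zero = + 1 ∷ []
  linearPower N (suc k) = mulLinear (+ 1) (+ N) (linearPower N k)

  evalℤ-linearPower : ∀ N k x → evalℤ (linearPower N k) x ≡ (+ 1 + + N * x) ^ k
  evalℤ-linearPower N zero x = cong (_+_ (+ 1)) (ℤ.*-zeroʳ x)
  evalℤ-linearPower N (suc k) x =
    trans (evalℤ-mulLinear (+ 1) (+ N) (linearPower N k) x) (cong ((+ 1 + + N * x) *_) (evalℤ-linearPower N k x))

module CoefficientSigns where

  open import Data.Nat using (ℕ; zero; suc; z≤n; s≤s)
  import Data.Nat as ℕ
  import Data.Nat.Properties as ℕ
  open import Data.Integer using (ℤ; +_; 0ℤ; +≤+; _+_; _-_; -_; _*_; _≤_; _<_)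
  import Data.Integer.Properties as ℤ
  open import Data.Integer.Tactic.RingSolver using (solve-∀)
  open import Data.Vec using (Vec; []; _∷_)
  open import Data.Product using (_×_; _,_; proj₁)
  open import Data.Sum using (inj₁; inj₂)
  open import Relation.Binary.PropositionalEquality using (_≡_; refl; sym; trans; cong; cong₂; subst; module ≡-Reasoning)
  open IntegerLemmas
  open IntegerPolynomials
  open LatticeCounts using (rising)

  coeff-beyond : ∀ {n} (p : Vec ℤ n) j → n ℕ.≤ j → coeff p j ≡ 0ℤ
  coeff-beyond [] j _ = refl
  coeff-beyond (a ∷ p) (suc j) (s≤s n≤j) = coeff-beyond p j n≤j

  coeff-shift-nonneg : ∀ {n} {p : Vec ℤ n} → (∀ j → 0ℤ ≤ coeff p j) → ∀ j → 0ℤ ≤ coeff (shift p) j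
  coeff-shift-nonneg p≥0 zero = 0≤+ 0
  coeff-shift-nonneg p≥0 (suc j) = p≥0 j

  Increasing : ∀ {m} → ℕ → Vec ℤ m → Set
  Increasing n p = ∀ j → j ℕ.≤ n → + 1 ≤ Δ p j

  WeaklyIncreasing : ∀ {m} → ℕ → Vec ℤ m → Set
  WeaklyIncreasing n p = (∀ j → j ℕ.< n → + 1 ≤ Δ p j) × 0ℤ ≤ Δ p n

  increasing⇒weakly : ∀ {m n} {p : Vec ℤ m} → Increasing n p → WeaklyIncreasing n p
  increasing⇒weakly p↑ = (λ j j<n → p↑ j (ℕ.<⇒≤ j<n)) , ℤ.≤-trans (0≤+ 1) (p↑ _ ℕ.≤-refl)

  private
    weakly-nonneg : ∀ {m n} {p : Vec ℤ m} → WeaklyIncreasing n p → ∀ j → j ℕ.≤ n → 0ℤ ≤ Δ p j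
    weakly-nonneg (below , at) j j≤n with ℕ.m≤n⇒m<n∨m≡n j≤n
    ... | inj₁ j<n = ℤ.≤-trans (0≤+ 1) (below j j<n)
    ... | inj₂ refl = at

  mulLinear-increasing : ∀ {m n a b} {p : Vec ℤ m} → + 1 ≤ a → + 1 ≤ b → + 1 ≤ Δ p 0 → WeaklyIncreasing n p →
    Increasing n (mulLinear a b p)
  mulLinear-increasing {a = a} {b} {p} 1≤a 1≤b 1≤Δ₀ p↑ zero _ = begin
    + 1                                   ≤⟨ 1≤-* 1≤a 1≤Δ₀ ⟩
    a * Δ p 0                             ≡⟨ ℤ.+-identityʳ (a * Δ p 0) ⟨
    a * Δ p 0 + 0ℤ                        ≡⟨ cong (_+_ (a * Δ p 0)) (ℤ.*-zeroʳ b) ⟨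
    a * Δ p 0 + b * Δ (shift p) 0         ≡⟨ Δ-mulLinear a b p 0 ⟨
    Δ (mulLinear a b p) 0                 ∎
    where open ℤ.≤-Reasoning
  mulLinear-increasing {a = a} {b} {p} 1≤a 1≤b 1≤Δ₀ p↑ (suc j) 1+j≤n = begin
    + 1
      ≤⟨ 1≤-* 1≤b (proj₁ p↑ j 1+j≤n) ⟩
    b * Δ p j
      ≤⟨ ≤-+-nonneg ℤ.≤-refl (0≤-* (ℤ.≤-trans (0≤+ 1) 1≤a) (weakly-nonneg {p = p} p↑ (suc j) 1+j≤n)) ⟩
    a * Δ p (suc j) + b * Δ (shift p) (suc j)
      ≡⟨ Δ-mulLinear a b p (suc j) ⟨
    Δ (mulLinear a b p) (suc j)
      ∎
    where open ℤ.≤-Reasoning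

  -- For p = (1 + N X)^k the field ratio is N·p_{k-1} = k·p_k; it is what shows that the top
  -- difference of (1 + N X)·p is (N − 1 − k)·p_k ≥ 0.
  record PowerShape (N k : ℕ) (p : Vec ℤ (suc k)) : Set where
    field
      nonneg           : ∀ j → 0ℤ ≤ coeff p j
      constant         : coeff p 0 ≡ + 1
      ratio            : + N * coeff (shift p) k ≡ + k * coeff p k
      weaklyIncreasing : WeaklyIncreasing k p

  module _ {N k} (1+k≤N : suc k ℕ.≤ N) (shape : PowerShape N k (linearPower N k)) where

    open PowerShape shape
    open ≡-Reasoning

    private
      p p′ : Vec ℤ _
      p = linearPower N k
      p′ = mulLinear (+ 1) (+ N) p

      p-top : coeff p (suc k) ≡ 0ℤ
      p-top = coeff-beyond p (suc k) ℕ.≤-refl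

      nonneg′ : ∀ j → 0ℤ ≤ coeff p′ j
      nonneg′ j = subst (0ℤ ≤_) (sym (coeff-mulLinear (+ 1) (+ N) p j))
        (0≤-+ (0≤-* (0≤+ 1) (nonneg j)) (0≤-* (0≤+ N) (coeff-shift-nonneg nonneg j)))

      constant′ : coeff p′ 0 ≡ + 1
      constant′ = begin
        coeff p′ 0                   ≡⟨ coeff-mulLinear (+ 1) (+ N) p 0 ⟩
        + 1 * coeff p 0 + + N * 0ℤ   ≡⟨ cong₂ (λ c z → + 1 * c + z) constant (ℤ.*-zeroʳ (+ N)) ⟩
        + 1                          ∎

      ratio′ : + N * coeff (shift p′) (suc k) ≡ + suc k * coeff p′ (suc k)
      ratio′ = begin
        + N * coeff p′ k
          ≡⟨ cong (+ N *_) (coeff-mulLinear (+ 1) (+ N) p k) ⟩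
        + N * (+ 1 * coeff p k + + N * coeff (shift p) k)
          ≡⟨ cong (λ e → + N * (+ 1 * coeff p k + e)) ratio ⟩
        + N * (+ 1 * coeff p k + + k * coeff p k)
          ≡⟨ regroup (+ N) (+ k) (coeff p k) ⟩
        + suc k * (+ 1 * 0ℤ + + N * coeff p k)
          ≡⟨ cong (λ e → + suc k * (+ 1 * e + + N * coeff p k)) p-top ⟨
        + suc k * (+ 1 * coeff p (suc k) + + N * coeff p k)
          ≡⟨ cong (+ suc k *_) (coeff-mulLinear (+ 1) (+ N) p (suc k)) ⟨
        + suc k * coeff p′ (suc k)
          ∎
        where
        regroup : ∀ N K a → N * (+ 1 * a + K * a) ≡ (+ 1 + K) * (+ 1 * 0ℤ + N * a)
        regroup = solve-∀

      increasing′ : Increasing k p′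
      increasing′ = mulLinear-increasing {p = p} ℤ.≤-refl (+≤+ (ℕ.≤-trans (s≤s z≤n) 1+k≤N))
        (ℤ.≤-reflexive (sym (trans (ℤ.+-identityʳ (coeff p 0)) constant))) weaklyIncreasing

      top-Δ′ : Δ p′ (suc k) ≡ (+ N - + suc k) * coeff p k
      top-Δ′ = begin
        Δ p′ (suc k)
          ≡⟨ Δ-mulLinear (+ 1) (+ N) p (suc k) ⟩
        + 1 * (coeff p (suc k) - coeff p k) + + N * (coeff p k - coeff (shift p) k)
          ≡⟨ cong (λ e → + 1 * (e - coeff p k) + + N * (coeff p k - coeff (shift p) k)) p-top ⟩
        + 1 * (0ℤ - coeff p k) + + N * (coeff p k - coeff (shift p) k)
          ≡⟨ expand (+ N) (coeff p k) (coeff (shift p) k) ⟩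
        + N * coeff p k - coeff p k - + N * coeff (shift p) k
          ≡⟨ cong (λ e → + N * coeff p k - coeff p k - e) ratio ⟩
        + N * coeff p k - coeff p k - + k * coeff p k
          ≡⟨ collect (+ N) (+ k) (coeff p k) ⟩
        (+ N - (+ 1 + + k)) * coeff p k
          ∎
        where
        expand : ∀ N a s → + 1 * (0ℤ - a) + N * (a - s) ≡ N * a - a - N * s
        expand = solve-∀
        collect : ∀ N K a → N * a - a - K * a ≡ (N - (+ 1 + K)) * a
        collect = solve-∀

    powerShape-suc : PowerShape N (suc k) (linearPower N (suc k))
    powerShape-suc = record
      { nonneg           = nonneg′
      ; constant         = constant′
      ; ratio            = ratio′
      ; weaklyIncreasing = (λ j j<1+k → increasing′ j (ℕ.≤-pred j<1+k)) ,
                           subst (0ℤ ≤_) (sym top-Δ′) (0≤-* (ℤ.i≤j⇒0≤j-i (+≤+ 1+k≤N)) (nonneg k))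
      }

  linearPower-shape : ∀ N k → k ℕ.≤ N → PowerShape N k (linearPower N k)
  linearPower-shape N zero _ = record
    { nonneg           = λ { zero → 0≤+ 1 ; (suc j) → 0≤+ 0 }
    ; constant         = refl
    ; ratio            = ℤ.*-zeroʳ (+ N)
    ; weaklyIncreasing = (λ _ ()) , 0≤+ 1
    }
  linearPower-shape N (suc k) 1+k≤N = powerShape-suc 1+k≤N (linearPower-shape N k (ℕ.≤-trans (ℕ.n≤1+n k) 1+k≤N))

  risingTimes : ∀ {m} (k : ℕ) → Vec ℤ m → Vec ℤ (k ℕ.+ m)
  risingTimes zero p = p
  risingTimes (suc k) p = mulLinear (+ suc k) (+ 1) (risingTimes k p)

  evalℤ-risingTimes : ∀ {m} k (p : Vec ℤ m) x → evalℤ (risingTimes k p) x ≡ rising k x * evalℤ p x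
  evalℤ-risingTimes zero p x = sym (ℤ.*-identityˡ (evalℤ p x))
  evalℤ-risingTimes (suc k) p x = begin
    evalℤ (mulLinear (+ suc k) (+ 1) (risingTimes k p)) x   ≡⟨ evalℤ-mulLinear (+ suc k) (+ 1) (risingTimes k p) x ⟩
    (+ suc k + + 1 * x) * evalℤ (risingTimes k p) x         ≡⟨ cong ((+ suc k + + 1 * x) *_) (evalℤ-risingTimes k p x) ⟩
    (+ suc k + + 1 * x) * (rising k x * evalℤ p x)          ≡⟨ regroup (+ k) x (rising k x) (evalℤ p x) ⟩
    rising k x * (x + + suc k) * evalℤ p x                  ∎
    where
    open ≡-Reasoning
    regroup : ∀ K x R e → (+ 1 + K + + 1 * x) * (R * e) ≡ R * (x + (+ 1 + K)) * e
    regroup = solve-∀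

  risingTimes-increasing : ∀ {m n} {p : Vec ℤ m} → 1 ℕ.≤ n → WeaklyIncreasing n p →
    ∀ k → Increasing n (risingTimes (suc k) p)
  risingTimes-increasing {p = p} 1≤n p↑ zero = mulLinear-increasing {p = p} ℤ.≤-refl ℤ.≤-refl (proj₁ p↑ 0 1≤n) p↑
  risingTimes-increasing {p = p} 1≤n p↑ (suc k) =
    mulLinear-increasing {a = + suc (suc k)} {p = q} (+≤+ (s≤s z≤n)) ℤ.≤-refl (q↑ 0 z≤n) (increasing⇒weakly {p = q} q↑)
    where
    q : Vec ℤ _
    q = risingTimes (suc k) p
    q↑ : Increasing _ q
    q↑ = risingTimes-increasing 1≤n p↑ k

  mulQuadratic-coeff-negative : ∀ {m} c₀ b M (p : Vec ℤ m) j → + 1 ≤ Δ p j → c₀ * coeff p (suc j) + b * coeff p j < + M →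
    coeff (mulQuadratic c₀ (b - + M) (+ M) p) (suc j) < 0ℤ
  mulQuadratic-coeff-negative c₀ b M p j 1≤Δ A<M = begin-strict
    coeff (mulQuadratic c₀ (b - + M) (+ M) p) (suc j)
      ≡⟨ coeff-mulQuadratic c₀ (b - + M) (+ M) p j ⟩
    c₀ * coeff p (suc j) + (b - + M) * coeff p j + + M * coeff (shift p) j
      ≡⟨ regroup c₀ b (+ M) (coeff p (suc j)) (coeff p j) (coeff (shift p) j) ⟩
    A - + M * Δ p j
      ≤⟨ ℤ.+-monoʳ-≤ A (ℤ.neg-mono-≤ (ℤ.*-monoˡ-≤-nonNeg (+ M) 1≤Δ)) ⟩
    A - + M * + 1
      ≡⟨ cong (λ e → A - e) (ℤ.*-identityʳ (+ M)) ⟩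
    A - + M
      <⟨ ℤ.+-monoˡ-< (- + M) A<M ⟩
    + M - + M
      ≡⟨ ℤ.+-inverseʳ (+ M) ⟩
    0ℤ
      ∎
    where
    open ℤ.≤-Reasoning
    A : ℤ
    A = c₀ * coeff p (suc j) + b * coeff p j
    regroup : ∀ c₀ b M a₁ a₀ s → c₀ * a₁ + (b - M) * a₀ + M * s ≡ c₀ * a₁ + b * a₀ - M * (a₀ - s)
    regroup = solve-∀

module EhrhartPolynomial where

  open import Data.Nat using (ℕ; zero; suc; _!)
  import Data.Nat as ℕ
  import Data.Nat.Properties as ℕ
  open import Data.Integer using (ℤ; +_; 0ℤ; +<+; _+_; _-_; _*_; _^_; _≤_; _<_)
  import Data.Integer.Properties as ℤ
  open import Data.Integer.Tactic.RingSolver using (solve-∀)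
  import Data.Nat.Tactic.RingSolver as ℕ-Solver
  open import Data.Rational as ℚ using (ℚ; 0ℚ)
  import Data.Rational.Properties as ℚ
  open import Data.Rational.Solver using (module +-*-Solver)
  open import Data.Fin using (Fin; toℕ)
  import Data.Fin as Fin
  open import Data.Vec using (Vec; []; _∷_; map; lookup; cast)
  open import Data.Vec.Properties using (lookup-map)
  open import Data.Product using (_,_; proj₁; proj₂)
  open import Relation.Binary.PropositionalEquality using (_≡_; refl; sym; trans; cong; cong₂; subst; module ≡-Reasoning)
  open import Defs
  open RationalEmbedding
  open IntegerLemmas
  open LatticeCounts
  open Dilation
  open IntegerPolynomials
  open CoefficientSigns

  evalPoly-scaled : ∀ {k} d (v : Vec ℤ k) x →
    evalPoly (map (λ c → d ℚ.* ℤ→ℚ c) v) (ℤ→ℚ x) ≡ d ℚ.* ℤ→ℚ (evalℤ v x)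
  evalPoly-scaled d [] x = sym (ℚ.*-zeroʳ d)
  evalPoly-scaled d (a ∷ v) x = begin
    d ℚ.* ℤ→ℚ a ℚ.+ ℤ→ℚ x ℚ.* evalPoly (map (λ c → d ℚ.* ℤ→ℚ c) v) (ℤ→ℚ x)
      ≡⟨ cong (λ e → d ℚ.* ℤ→ℚ a ℚ.+ ℤ→ℚ x ℚ.* e) (evalPoly-scaled d v x) ⟩
    d ℚ.* ℤ→ℚ a ℚ.+ ℤ→ℚ x ℚ.* (d ℚ.* ℤ→ℚ (evalℤ v x))
      ≡⟨ solve 4 (λ d A X e → d :* A :+ X :* (d :* e) := d :* (A :+ X :* e)) refl
                 d (ℤ→ℚ a) (ℤ→ℚ x) (ℤ→ℚ (evalℤ v x)) ⟩
    d ℚ.* (ℤ→ℚ a ℚ.+ ℤ→ℚ x ℚ.* ℤ→ℚ (evalℤ v x))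
      ≡⟨ cong (d ℚ.*_) (trans (ℤ→ℚ-+ a (x * evalℤ v x)) (cong (ℤ→ℚ a ℚ.+_) (ℤ→ℚ-* x (evalℤ v x)))) ⟨
    d ℚ.* ℤ→ℚ (a + x * evalℤ v x)
      ∎
    where
    open ≡-Reasoning
    open +-*-Solver

  evalℤ-cast : ∀ {m n} .(eq : m ≡ n) (v : Vec ℤ m) x → evalℤ (cast eq v) x ≡ evalℤ v x
  evalℤ-cast {n = zero} eq [] x = refl
  evalℤ-cast {n = suc n} eq (a ∷ v) x = cong (λ e → a + x * e) (evalℤ-cast {n = n} _ v x)

  lookup-cast≡coeff : ∀ {m n} .(eq : m ≡ n) (v : Vec ℤ m) (j : Fin n) → lookup (cast eq v) j ≡ coeff v (toℕ j)
  lookup-cast≡coeff {n = suc _} eq (a ∷ v) Fin.zero = refl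
  lookup-cast≡coeff {n = suc n} eq (a ∷ v) (Fin.suc j) = lookup-cast≡coeff {n = n} _ v j

  pos-^ : ∀ a k → + (a ℕ.^ k) ≡ (+ a) ^ k
  pos-^ a zero = refl
  pos-^ a (suc k) = trans (ℤ.pos-* a (a ℕ.^ k)) (cong (+ a *_) (pos-^ a k))

  module _ (n r : ℕ) where

    private
      c₀ b : ℤ
      c₀ = (+ r + + 2) * (+ r + + 3)
      b = + 2 * (+ r + + 3)

      E : Vec ℤ (suc n)
      E = linearPower n n

      R : Vec ℤ (suc r ℕ.+ suc n)
      R = risingTimes (suc r) E

      D : ℕ
      D = (r ℕ.+ 3) !

      1+pred[D]≡D : suc (ℕ.pred D) ≡ D
      1+pred[D]≡D = ℕ.suc-pred D {{(r ℕ.+ 3) ℕ.!≢0}}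

      open Reciprocal (ℕ.pred D) renaming (τ to δ; τ⁻¹ to δ⁻¹)

      length≡ : suc (suc (suc r ℕ.+ suc n)) ≡ n ℕ.+ r ℕ.+ 4
      length≡ = rearrange n r
        where
        rearrange : ∀ n r → suc (suc (suc r ℕ.+ suc n)) ≡ n ℕ.+ r ℕ.+ 4
        rearrange = ℕ-Solver.solve-∀

    ehrhartNumerator : ℕ → Vec ℤ (suc (suc (suc r ℕ.+ suc n)))
    ehrhartNumerator mm = mulQuadratic c₀ (b - + suc mm) (+ suc mm) R

    ehrhartCoefficients : ℕ → Vec ℚ (n ℕ.+ r ℕ.+ 4)
    ehrhartCoefficients mm = map (λ c → δ⁻¹ ℚ.* ℤ→ℚ c) (cast length≡ (ehrhartNumerator mm))

    evalℤ-ehrhartNumerator : ∀ mm t →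
      evalℤ (ehrhartNumerator mm) (+ t) ≡ + (D ℕ.* (pyrReeveCount mm r t ℕ.* suc (t ℕ.* n) ℕ.^ n))
    evalℤ-ehrhartNumerator mm t = begin
      evalℤ (mulQuadratic c₀ (b - M) M R) T
        ≡⟨ evalℤ-mulQuadratic c₀ (b - M) M R T ⟩
      (c₀ + (b - M) * T + M * T * T) * evalℤ R T
        ≡⟨ cong ((c₀ + (b - M) * T + M * T * T) *_)
                (trans (evalℤ-risingTimes (suc r) E T) (cong (rising (suc r) T *_) (evalℤ-linearPower n n T))) ⟩
      (c₀ + (b - M) * T + M * T * T) * (rising (suc r) T * (+ 1 + + n * T) ^ n)
        ≡⟨ reorder (+ r) M T (rising (suc r) T) ((+ 1 + + n * T) ^ n) ⟩
      rising (suc r) T * quadraticFactor M r T * (+ 1 + + n * T) ^ n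
        ≡⟨ cong₂ _*_ (sym (pyrReeveCount-formula mm r t)) (cong (_^ n) 1+nt≡) ⟩
      + (D ℕ.* pyrReeveCount mm r t) * (+ suc (t ℕ.* n)) ^ n
        ≡⟨ cong (+ (D ℕ.* pyrReeveCount mm r t) *_) (pos-^ (suc (t ℕ.* n)) n) ⟨
      + (D ℕ.* pyrReeveCount mm r t) * + (suc (t ℕ.* n) ℕ.^ n)
        ≡⟨ ℤ.pos-* (D ℕ.* pyrReeveCount mm r t) _ ⟨
      + (D ℕ.* pyrReeveCount mm r t ℕ.* suc (t ℕ.* n) ℕ.^ n)
        ≡⟨ cong +_ (ℕ.*-assoc D (pyrReeveCount mm r t) _) ⟩
      + (D ℕ.* (pyrReeveCount mm r t ℕ.* suc (t ℕ.* n) ℕ.^ n))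
        ∎
      where
      open ≡-Reasoning
      M T : ℤ
      M = + suc mm
      T = + t
      1+nt≡ : + 1 + + n * T ≡ + suc (t ℕ.* n)
      1+nt≡ = cong (_+_ (+ 1)) (trans (sym (ℤ.pos-* n t)) (cong +_ (ℕ.*-comm n t)))
      reorder : ∀ R M T X W → ((R + + 2) * (R + + 3) + (+ 2 * (R + + 3) - M) * T + M * T * T) * (X * W) ≡
        X * (M * T * T - M * T + + 2 * (R + + 3) * T + (R + + 2) * (R + + 3)) * W
      reorder = solve-∀

    ehrhartCoefficients-isEhrhart : ∀ mm → IsEhrhartPoly (thePolytope (suc mm) n r) (ehrhartCoefficients mm)
    ehrhartCoefficients-isEhrhart mm (suc k) _ = count , thePolytope-latticeCount k mm n r , (begin
      evalPoly (ehrhartCoefficients mm) (ℤ→ℚ (+ suc k))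
        ≡⟨ evalPoly-scaled δ⁻¹ (cast length≡ (ehrhartNumerator mm)) (+ suc k) ⟩
      δ⁻¹ ℚ.* ℤ→ℚ (evalℤ (cast length≡ (ehrhartNumerator mm)) (+ suc k))
        ≡⟨ cong (λ e → δ⁻¹ ℚ.* ℤ→ℚ e)
                 (trans (evalℤ-cast length≡ (ehrhartNumerator mm) (+ suc k)) (evalℤ-ehrhartNumerator mm (suc k))) ⟩
      δ⁻¹ ℚ.* ℤ→ℚ (+ (D ℕ.* count))
        ≡⟨ cong (λ e → δ⁻¹ ℚ.* ℤ→ℚ e)
                 (trans (cong (λ d → + (d ℕ.* count)) (sym 1+pred[D]≡D)) (ℤ.pos-* (suc (ℕ.pred D)) count)) ⟩
      δ⁻¹ ℚ.* ℤ→ℚ (+ suc (ℕ.pred D) * + count)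
        ≡⟨ cong (δ⁻¹ ℚ.*_) (ℤ→ℚ-* (+ suc (ℕ.pred D)) (+ count)) ⟩
      δ⁻¹ ℚ.* (δ ℚ.* ℤ→ℚ (+ count))
        ≡⟨ τ⁻¹*[τ*q]≡q (ℤ→ℚ (+ count)) ⟩
      ℤ→ℚ (+ count)
        ∎)
      where
      open ≡-Reasoning
      count : ℕ
      count = pyrReeveCount mm r (suc k) ℕ.* suc (suc k ℕ.* n) ℕ.^ n

    private
      A : ℕ → ℤ
      A j = c₀ * coeff R (suc j) + b * coeff R j

      R-increasing : 1 ℕ.≤ n → Increasing n R
      R-increasing 1≤n = risingTimes-increasing {p = E} 1≤n (PowerShape.weaklyIncreasing (linearPower-shape n n ℕ.≤-refl)) r

    threshold : ℕ
    threshold = suc (proj₁ (finite-bound A n))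

    ehrhartNumerator-negative : 1 ℕ.≤ n → ∀ mm → threshold ℕ.≤ suc mm → ∀ i → 1 ℕ.≤ i → i ℕ.≤ n ℕ.+ 1 →
      coeff (ehrhartNumerator mm) i < 0ℤ
    ehrhartNumerator-negative 1≤n mm threshold≤m (suc i) _ 1+i≤n+1 =
      mulQuadratic-coeff-negative c₀ b (suc mm) R i (R-increasing 1≤n i i≤n)
        (ℤ.≤-<-trans (proj₂ (finite-bound A n) i i≤n) (+<+ threshold≤m))
      where
      i≤n : i ℕ.≤ n
      i≤n = ℕ.≤-pred (subst (suc i ℕ.≤_) (ℕ.+-comm n 1) 1+i≤n+1)

    ehrhartCoefficients-negative : 1 ℕ.≤ n → ∀ mm → threshold ℕ.≤ suc mm →
      (j : Fin (n ℕ.+ r ℕ.+ 4)) → 1 ℕ.≤ toℕ j → toℕ j ℕ.≤ n ℕ.+ 1 → lookup (ehrhartCoefficients mm) j ℚ.< 0ℚ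
    ehrhartCoefficients-negative 1≤n mm threshold≤m j 1≤j j≤n+1 = begin-strict
      lookup (ehrhartCoefficients mm) j
        ≡⟨ lookup-map j (λ c → δ⁻¹ ℚ.* ℤ→ℚ c) (cast length≡ (ehrhartNumerator mm)) ⟩
      δ⁻¹ ℚ.* ℤ→ℚ (lookup (cast length≡ (ehrhartNumerator mm)) j)
        ≡⟨ cong (λ e → δ⁻¹ ℚ.* ℤ→ℚ e) (lookup-cast≡coeff length≡ (ehrhartNumerator mm) j) ⟩
      δ⁻¹ ℚ.* ℤ→ℚ (coeff (ehrhartNumerator mm) (toℕ j))
        <⟨ ℚ.*-monoʳ-<-pos δ⁻¹ {{ℚ.positive 0<τ⁻¹}}
              (ℤ→ℚ-mono-< (ehrhartNumerator-negative 1≤n mm threshold≤m (toℕ j) 1≤j j≤n+1)) ⟩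
      δ⁻¹ ℚ.* 0ℚ
        ≡⟨ ℚ.*-zeroʳ δ⁻¹ ⟩
      0ℚ
        ∎
      where open ℚ.≤-Reasoning

open EhrhartPolynomial
open import Data.Nat using (zero; suc)
open import Data.Product using (_,_)

open import Defs
open import Data.Nat using (ℕ; _≤_; _+_)
open import Data.Rational using (ℚ; _<_; 0ℚ)
open import Data.Fin using (Fin; toℕ)
open import Data.Vec using (Vec; lookup)
open import Data.Product using (Σ; _×_)

theorem3p8 : (n r : ℕ) → 1 ≤ n → 1 ≤ r →
    Σ ℕ λ M → (m : ℕ) → 1 ≤ m → M ≤ m →
      Σ (Vec ℚ (n + r + 4)) λ a → IsEhrhartPoly (thePolytope m n r) a
        × ((j : Fin (n + r + 4)) → 1 ≤ toℕ j → toℕ j ≤ n + 1 → lookup a j < 0ℚ)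
theorem3p8 n r 1≤n _ = threshold n r , λ
  { zero () _
  ; (suc mm) _ threshold≤m →
      ehrhartCoefficients n r mm , ehrhartCoefficients-isEhrhart n r mm , ehrhartCoefficients-negative n r 1≤n mm threshold≤m
  }
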